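{- For every finite set of variables $\vec{x}\subseteq\mathrm{Var}$ and all formulas $\phi,\psi$ with $\mathrm{fv}(\phi)\subseteq\vec{x}$ and $\mathrm{fv}(\psi)\subseteq\vec{x}$, it is decidable whether $\phi\models_{\vec{x}}\psi$.
   Context: $\mathrm{Loc}$ is an infinite set of locations, $\mathrm{Var}$ an infinite set of variables containing $\mathsf{nil}$. A stack is a partial function $s:\mathrm{Var}\rightharpoonup\mathrm{Loc}$; a heap is a finite partial function $h:\mathrm{Loc}\rightharpoonup\mathrm{Loc}$; a model is $(s,h)$ with $\mathsf{nil}\in\mathrm{dom}(s)$, $s(\mathsf{nil})\notin\mathrm{dom}(h)$. $\mathrm{locs}(h)=\mathrm{dom}(h)\cup\mathrm{img}(h)$; $h_1\uplus^s h_2:=h_1\cup h_2$ if $\mathrm{dom}(h_1)\cap\mathrm{dom}(h_2)=\emptyset$ and $\mathrm{locs}(h_1)\cap\mathrm{locs}(h_2)\subseteq\mathrm{img}(s)$, else undefined ($\bot$). Formulas: atoms $\mathsf{emp}$, $x\mapsto y$, $\mathsf{ls}(x,y)$, $x=y$, $x\neq y$, closed under $*$, $\mathbin{ -\!\circledast}$ (septraction), $\wedge,\vee,\neg$; $\mathrm{fv}(\phi)$ is the set of variables of $\phi$. Strong semantics $\models$: $\mathsf{emp}$ holds iff $\mathrm{dom}(h)=\emptyset$; $x=y$ (resp. $x\neq y$) iff $\mathrm{dom}(h)=\emptyset$ and $s(x)=s(y)$ (resp. $\neq$); $x\mapsto y$ iff $h=\{s(x)\mapsto s(y)\}$; $\mathsf{ls}(x,y)$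 iff either $\mathrm{dom}(h)=\emptyset$ and $s(x)=s(y)$, or $h=\{l_0\mapsto l_1,\dots,l_{n-1}\mapsto l_n\}$ for some $n\ge1$ with $s(x)=l_0$, $s(y)=l_n$; Boolean connectives classical; $\phi_1*\phi_2$ iff $h=h_1\uplus^s h_2$ with $(s,h_i)\models\phi_i$; $\phi_1\mathbin{ -\!\circledast}\phi_2$ iff some $h_1$ has $(s,h_1)\models\phi_1$, $h\uplus^s h_1\neq\bot$, $(s,h\uplus^s h_1)\models\phi_2$. Entailment: $\phi\models_{\vec{x}}\psi$ iff every model $(s,h)$ with $\mathrm{dom}(s)=\vec{x}$ and $(s,h)\models\phi$ also satisfies $(s,h)\models\psi$. -}

module Defs where

open import Data.Nat using (ℕ; zero; suc)
open import Data.Nat.Properties using (_≟_)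
open import Data.Maybe using (Maybe; just; nothing)
open import Data.List using (List; []; _∷_; map; _++_)
open import Data.List.Membership.Propositional using (_∈_)
open import Data.List.Relation.Unary.Unique.Propositional using (Unique)
open import Data.Product using (Σ; ∃; _×_; _,_; proj₁)
open import Data.Sum using (_⊎_)
open import Relation.Nullary using (¬_; yes; no)
open import Relation.Binary.PropositionalEquality using (_≡_; _≢_)

Loc : Set
Loc = ℕ

Var : Set
Var = ℕ

nil : Var
nil = 0

Stack : Set
Stack = Var → Maybe Loc

record Heap : Set where
  field
    fn  : Loc → Maybe Loc
    fin : Σ (List Loc) (λ L → ∀ l v → fn l ≡ just v → l ∈ L)
open Heap public

inDom : Heap → Loc → Set
inDom h l = ∃ λ v → fn h l ≡ just v

inImg : Heap → Loc → Set
inImg h l = ∃ λ k → fn h k ≡ just l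

inLocs : Heap → Loc → Set
inLocs h l = inDom h l ⊎ inImg h l

imgS : Stack → Loc → Set
imgS s l = ∃ λ x → s x ≡ just l

EmptyHeap : Heap → Set
EmptyHeap h = ∀ l → fn h l ≡ nothing

IsModel : Stack → Heap → Set
IsModel s h = ∃ λ n → s nil ≡ just n × ¬ inDom h n

DomIs : Stack → List Var → Set
DomIs s xs = ∀ v → (v ∈ xs → ∃ λ l → s v ≡ just l) × (∀ l → s v ≡ just l → v ∈ xs)

lookupL : List (Loc × Loc) → Loc → Maybe Loc
lookupL [] l = nothing
lookupL ((a , b) ∷ ps) l with a ≟ l
... | yes _ = just b
... | no  _ = lookupL ps l

Compatible : Stack → Heap → Heap → Set
Compatible s h1 h2 =
  (∀ l → ¬ (inDom h1 l × inDom h2 l)) ×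
  (∀ l → inLocs h1 l → inLocs h2 l → imgS s l)

merge : Maybe Loc → Maybe Loc → Maybe Loc
merge (just v) _ = just v
merge nothing m = m

IsUnionS : Stack → Heap → Heap → Heap → Set
IsUnionS s h h1 h2 = Compatible s h1 h2 × (∀ l → fn h l ≡ merge (fn h1 l) (fn h2 l))

cells : Loc → List Loc → List (Loc × Loc)
cells a [] = []
cells a (b ∷ bs) = (a , b) ∷ cells b bs

lastL : Loc → List Loc → Loc
lastL a [] = a
lastL a (b ∷ bs) = lastL b bs

data Form : Set where
  emp  : Form
  _↦_  : Var → Var → Form
  ls   : Var → Var → Form
  _≐_  : Var → Var → Form
  _≠_  : Var → Var → Form
  _⋆_  : Form → Form → Form
  _-⊛_ : Form → Form → Form
  _∧f_ : Form → Form → Form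
  _∨f_ : Form → Form → Form
  ¬f_  : Form → Form

fv : Form → List Var
fv emp = []
fv (x ↦ y) = x ∷ y ∷ []
fv (ls x y) = x ∷ y ∷ []
fv (x ≐ y) = x ∷ y ∷ []
fv (x ≠ y) = x ∷ y ∷ []
fv (φ ⋆ ψ) = fv φ ++ fv ψ
fv (φ -⊛ ψ) = fv φ ++ fv ψ
fv (φ ∧f ψ) = fv φ ++ fv ψ
fv (φ ∨f ψ) = fv φ ++ fv ψ
fv (¬f φ) = fv φ

_,_⊨_ : Stack → Heap → Form → Set
s , h ⊨ emp = EmptyHeap h
s , h ⊨ (x ≐ y) = EmptyHeap h × (∃ λ a → s x ≡ just a × s y ≡ just a)
s , h ⊨ (x ≠ y) = EmptyHeap h × (∃ λ a → ∃ λ b → s x ≡ just a × s y ≡ just b × a ≢ b)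
s , h ⊨ (x ↦ y) = ∃ λ a → ∃ λ b → s x ≡ just a × s y ≡ just b ×
                    (∀ l → fn h l ≡ lookupL ((a , b) ∷ []) l)
s , h ⊨ ls x y =
  (EmptyHeap h × (∃ λ a → s x ≡ just a × s y ≡ just a)) ⊎
  (∃ λ a → ∃ λ b → ∃ λ bs → s x ≡ just a × s y ≡ just (lastL a (b ∷ bs)) ×
     Unique (map proj₁ (cells a (b ∷ bs))) ×
     (∀ l → fn h l ≡ lookupL (cells a (b ∷ bs)) l))
s , h ⊨ (φ ⋆ ψ) = ∃ λ h1 → ∃ λ h2 → IsUnionS s h h1 h2 × (s , h1 ⊨ φ) × (s , h2 ⊨ ψ)
s , h ⊨ (φ -⊛ ψ) = ∃ λ h1 → ∃ λ h' → IsModel s h1 × (s , h1 ⊨ φ) ×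
                     IsUnionS s h' h h1 × (s , h' ⊨ ψ)
s , h ⊨ (φ ∧f ψ) = (s , h ⊨ φ) × (s , h ⊨ ψ)
s , h ⊨ (φ ∨f ψ) = (s , h ⊨ φ) ⊎ (s , h ⊨ ψ)
s , h ⊨ (¬f φ) = ¬ (s , h ⊨ φ)

Entails : List Var → Form → Form → Set
Entails xs φ ψ = ∀ (s : Stack) (h : Heap) → DomIs s xs → IsModel s h →
                 (s , h ⊨ φ) → (s , h ⊨ ψ)

-- Fix a stack. Call two heap cells linked when they have the same source or share a location
-- that is no variable's value. As ⊎ˢ may only share values of variables, every split or
-- extension of a heap respects the connected components of this relation, its chunks. A chunk
-- allocating some variable's value matters only through its type: a single cell between two
-- variables, a list segment of length ≥ 2 between two variables through unnamed locations, or
-- garbage allocating a given set of variables; there are at most as many such chunks as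
-- variables. The other, anonymous chunks are interchangeable, and a formula cannot count them
-- beyond a bound read off its syntax. So whether a formula holds depends only on the aliasing of
-- the variables, the list of chunk types and the capped number of anonymous chunks, which the
-- Boolean function sat evaluates; and each such abstract state is realised by a model. An
-- entailment is therefore decided by checking finitely many abstract states.

module Submission where

open import Data.Bool using (Bool; true; false; _∧_; _∨_; not)
open import Data.Bool.ListAction using (any; all)
open import Data.Empty
open import Data.Fin using (Fin; zero; suc; toℕ)
open import Data.Fin.Properties using (any?)
open import Data.List using (List; []; _∷_; _++_; map; length; null; foldr; concatMap; cartesianProductWith; allFin; upTo; concat; filter)
open import Data.List.Membership.Propositional using (_∈_; _∉_; find)
open import Data.List.Membership.Propositional.Properties
open import Data.List.Properties using (length-++; length-map; length-tabulate; map-++; ∷-injectiveˡ; ∷-injectiveʳ; length-++-sucʳ)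
open import Data.List.Relation.Binary.Subset.Propositional using (_⊆_)
open import Data.List.Relation.Ternary.Interleaving.Propositional using (Interleaving; []; consˡ; consʳ; swap)
open import Data.List.Relation.Unary.All using (All; []; _∷_)
open import Data.List.Relation.Unary.AllPairs using (AllPairs; []; _∷_; allPairs?)
open import Data.List.Relation.Unary.Any using (Any; here; there; index)
open import Data.List.Relation.Unary.Any.Properties using (lookup-index)
open import Data.List.Relation.Unary.Unique.Propositional using (Unique)
open import Data.Maybe using (Maybe; just; nothing)
open import Data.Maybe.Properties using (just-injective)
open import Data.Nat using (ℕ; zero; suc; _+_; _∸_; _≤_; _<_; z≤n; s≤s; s≤s⁻¹; _⊔_; _⊓_; _≡ᵇ_)
open import Data.Nat.Properties
open import Data.List.Membership.DecPropositional _≟_ using (_∈?_)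
open import Data.Product using (Σ; ∃; ∃₂; _×_; _,_; proj₁; proj₂)
open import Data.Product.Properties using (≡-dec)
open import Data.Sum using (_⊎_; inj₁; inj₂)
open import Data.Vec using (Vec; []; _∷_; lookup; tabulate)
open import Data.Vec.Properties using (lookup∘tabulate; tabulate-cong)
open import Function using (id)
open import Function.Bundles using (_⇔_; mk⇔; Equivalence)
open import Relation.Binary.Definitions using (DecidableEquality)
open import Relation.Binary.PropositionalEquality
open import Relation.Nullary
open import Relation.Nullary.Decidable using (⌊_⌋; map′; _×-dec_; _⊎-dec_; ¬?)

import Data.Bool as Bool
import Data.Fin.Properties as Fin
import Data.List as L
import Data.List.Membership.DecPropositional as DecMembership
import Data.List.Relation.Unary.All as All
import Data.List.Relation.Unary.AllPairs.Properties as AllPairs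
import Data.List.Relation.Unary.Any as Any
import Data.List.Relation.Unary.Unique.Propositional.Properties as Unique
import Data.Maybe as Maybe
import Data.Maybe.Properties as Maybeₚ
import Data.Sum as Sum

open import Defs

∧-intro : ∀ {a b} → a ≡ true → b ≡ true → a ∧ b ≡ true
∧-intro refl refl = refl

∧-elimˡ : ∀ a {b} → a ∧ b ≡ true → a ≡ true
∧-elimˡ true _ = refl

∧-elimʳ : ∀ a {b} → a ∧ b ≡ true → b ≡ true
∧-elimʳ true p = p

∨-introˡ : ∀ {a} b → a ≡ true → a ∨ b ≡ true
∨-introˡ b refl = refl

∨-introʳ : ∀ a {b} → b ≡ true → a ∨ b ≡ true
∨-introʳ true _ = refl
∨-introʳ false p = p

∨-elim : ∀ a {b} → a ∨ b ≡ true → a ≡ true ⊎ b ≡ true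
∨-elim true _ = inj₁ refl
∨-elim false p = inj₂ p

not-intro : ∀ a → (a ≡ true → ⊥) → not a ≡ true
not-intro true f = ⊥-elim (f refl)
not-intro false _ = refl

not-elim : ∀ a → not a ≡ true → a ≡ true → ⊥
not-elim true () _

any-intro : ∀ {A : Set} (p : A → Bool) {x : A} {xs} → x ∈ xs → p x ≡ true → any p xs ≡ true
any-intro p {xs = y ∷ ys} (here refl) q = ∨-introˡ (any p ys) q
any-intro p {xs = y ∷ ys} (there m) q = ∨-introʳ (p y) (any-intro p m q)

any-elim : ∀ {A : Set} (p : A → Bool) xs → any p xs ≡ true → ∃ λ x → x ∈ xs × p x ≡ true
any-elim p (y ∷ ys) q with ∨-elim (p y) q
... | inj₁ r = y , here refl , r
... | inj₂ r with any-elim p ys r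
... | x , m , r′ = x , there m , r′

all-intro : ∀ {A : Set} (p : A → Bool) xs → (∀ x → x ∈ xs → p x ≡ true) → all p xs ≡ true
all-intro p [] h = refl
all-intro p (y ∷ ys) h = ∧-intro (h y (here refl)) (all-intro p ys (λ x m → h x (there m)))

all-elim : ∀ {A : Set} (p : A → Bool) {x} xs → all p xs ≡ true → x ∈ xs → p x ≡ true
all-elim p (y ∷ ys) q (here refl) = ∧-elimˡ (p y) q
all-elim p (y ∷ ys) q (there m) = all-elim p ys (∧-elimʳ (p y) q) m

all-false : ∀ {A : Set} (p : A → Bool) xs → all p xs ≡ false → ∃ λ x → x ∈ xs × p x ≡ false
all-false p (x ∷ xs) q with p x in eq
... | false = x , here refl , eq
... | true with all-false p xs q
... | y , m , r = y , there m , r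

module _ {A : Set} where

  ∈-interleavingˡ : ∀ {x : A} {xs ys zs} → Interleaving xs ys zs → x ∈ xs → x ∈ zs
  ∈-interleavingˡ (consˡ i) (here p) = here p
  ∈-interleavingˡ (consˡ i) (there m) = there (∈-interleavingˡ i m)
  ∈-interleavingˡ (consʳ i) m = there (∈-interleavingˡ i m)

  ∈-interleavingʳ : ∀ {x : A} {xs ys zs} → Interleaving xs ys zs → x ∈ ys → x ∈ zs
  ∈-interleavingʳ i = ∈-interleavingˡ (swap i)

  ∈-interleaving⁻ : ∀ {x : A} {xs ys zs} → Interleaving xs ys zs → x ∈ zs → x ∈ xs ⊎ x ∈ ys
  ∈-interleaving⁻ (consˡ i) (here p) = inj₁ (here p)
  ∈-interleaving⁻ (consʳ i) (here p) = inj₂ (here p)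
  ∈-interleaving⁻ (consˡ i) (there m) = Sum.map there id (∈-interleaving⁻ i m)
  ∈-interleaving⁻ (consʳ i) (there m) = Sum.map id there (∈-interleaving⁻ i m)

  All-interleaving⁻ : ∀ {P : A → Set} {xs ys zs} → Interleaving xs ys zs → All P zs → All P xs × All P ys
  All-interleaving⁻ [] [] = [] , []
  All-interleaving⁻ (consˡ i) (p ∷ ps) = let (a , b) = All-interleaving⁻ i ps in (p ∷ a) , b
  All-interleaving⁻ (consʳ i) (p ∷ ps) = let (a , b) = All-interleaving⁻ i ps in a , (p ∷ b)

  AllPairs-interleaving⁻ : ∀ {R : A → A → Set} {xs ys zs} → Interleaving xs ys zs → AllPairs R zs → AllPairs R xs × AllPairs R ys
  AllPairs-interleaving⁻ [] [] = [] , []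
  AllPairs-interleaving⁻ (consˡ i) (p ∷ ps) = let (a , b) = AllPairs-interleaving⁻ i ps in (proj₁ (All-interleaving⁻ i p) ∷ a) , b
  AllPairs-interleaving⁻ (consʳ i) (p ∷ ps) = let (a , b) = AllPairs-interleaving⁻ i ps in a , (proj₂ (All-interleaving⁻ i p) ∷ b)

  AllPairs-interleaving-across : ∀ {R : A → A → Set} → (∀ {x y} → R x y → R y x) → ∀ {xs ys zs} → Interleaving xs ys zs →
    AllPairs R zs → ∀ {x y} → x ∈ xs → y ∈ ys → R x y
  AllPairs-interleaving-across sym (consˡ i) (p ∷ ps) (here refl) m = All.lookup p (∈-interleavingʳ i m)
  AllPairs-interleaving-across sym (consˡ i) (p ∷ ps) (there m₁) m₂ = AllPairs-interleaving-across sym i ps m₁ m₂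
  AllPairs-interleaving-across sym (consʳ i) (p ∷ ps) m (here refl) = sym (All.lookup p (∈-interleavingˡ i m))
  AllPairs-interleaving-across sym (consʳ i) (p ∷ ps) m₁ (there m₂) = AllPairs-interleaving-across sym i ps m₁ m₂

  interleaving-middle : (pre : List A) (x : A) (post : List A) → Interleaving (x ∷ []) (pre ++ post) (pre ++ x ∷ post)
  interleaving-middle [] x post = consˡ (swap (onlyˡ post))
    where
    onlyˡ : ∀ zs → Interleaving zs [] zs
    onlyˡ [] = []
    onlyˡ (z ∷ zs) = consˡ (onlyˡ zs)
  interleaving-middle (p ∷ pre) x post = consʳ (interleaving-middle pre x post)

  splits : List A → List (List A × List A)
  splits [] = ([] , []) ∷ []
  splits (z ∷ zs) = map (λ p → (z ∷ proj₁ p , proj₂ p)) (splits zs) ++ map (λ p → (proj₁ p , z ∷ proj₂ p)) (splits zs)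

  ∈-splits⁺ : ∀ {xs ys zs : List A} → Interleaving xs ys zs → (xs , ys) ∈ splits zs
  ∈-splits⁺ [] = here refl
  ∈-splits⁺ {zs = z ∷ zs} (consˡ i) = ∈-++⁺ˡ (∈-map⁺ (λ p → (z ∷ proj₁ p , proj₂ p)) (∈-splits⁺ i))
  ∈-splits⁺ {zs = z ∷ zs} (consʳ i) =
    ∈-++⁺ʳ (map (λ p → (z ∷ proj₁ p , proj₂ p)) (splits zs)) (∈-map⁺ (λ p → (proj₁ p , z ∷ proj₂ p)) (∈-splits⁺ i))

  ∈-splits⁻ : ∀ {xs ys : List A} zs → (xs , ys) ∈ splits zs → Interleaving xs ys zs
  ∈-splits⁻ [] (here refl) = []
  ∈-splits⁻ (z ∷ zs) m with ∈-++⁻ (map (λ p → (z ∷ proj₁ p , proj₂ p)) (splits zs)) m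
  ... | inj₁ m₁ with ∈-map⁻ (λ p → (z ∷ proj₁ p , proj₂ p)) m₁
  ... | _ , m₂ , refl = consˡ (∈-splits⁻ zs m₂)
  ∈-splits⁻ (z ∷ zs) m | inj₂ m₁ with ∈-map⁻ (λ p → (proj₁ p , z ∷ proj₂ p)) m₁
  ... | _ , m₂ , refl = consʳ (∈-splits⁻ zs m₂)

  picks : List A → List (A × List A)
  picks [] = []
  picks (x ∷ xs) = (x , xs) ∷ map (λ p → (proj₁ p , x ∷ proj₂ p)) (picks xs)

  ∈-picks⁺ : (pre : List A) (y : A) (post : List A) → (y , pre ++ post) ∈ picks (pre ++ y ∷ post)
  ∈-picks⁺ [] y post = here refl
  ∈-picks⁺ (x ∷ pre) y post = there (∈-map⁺ (λ p → (proj₁ p , x ∷ proj₂ p)) (∈-picks⁺ pre y post))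

  ∈-picks⁻ : (zs : List A) {y : A} {R : List A} → (y , R) ∈ picks zs →
    ∃₂ λ pre post → zs ≡ pre ++ y ∷ post × R ≡ pre ++ post
  ∈-picks⁻ (x ∷ xs) (here refl) = [] , xs , refl , refl
  ∈-picks⁻ (x ∷ xs) (there m) with ∈-map⁻ (λ p → (proj₁ p , x ∷ proj₂ p)) m
  ... | _ , m′ , refl with ∈-picks⁻ xs m′
  ... | pre , post , refl , refl = x ∷ pre , post , refl , refl

  Unique-⊆⇒length≤ : ∀ {xs ys : List A} → Unique xs → (∀ x → x ∈ xs → x ∈ ys) → length xs ≤ length ys
  Unique-⊆⇒length≤ {[]} u h = z≤n
  Unique-⊆⇒length≤ {x ∷ xs} (x∉xs ∷ u) h with ∈-∃++ (h x (here refl))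
  ... | pre , post , refl = ≤-trans (s≤s (Unique-⊆⇒length≤ u h′)) (≤-reflexive (sym length-pre-x-post))
    where
    h′ : ∀ y → y ∈ xs → y ∈ pre ++ post
    h′ y m with ∈-++⁻ pre (h y (there m))
    ... | inj₁ m₁ = ∈-++⁺ˡ m₁
    ... | inj₂ (here refl) = ⊥-elim (All.lookup x∉xs m refl)
    ... | inj₂ (there m₁) = ∈-++⁺ʳ pre m₁
    length-pre-x-post : length (pre ++ x ∷ post) ≡ suc (length (pre ++ post))
    length-pre-x-post = trans (length-++ pre) (trans (+-suc (length pre) (length post)) (cong suc (sym (length-++ pre))))

lookupL-sound : ∀ ps {l v} → lookupL ps l ≡ just v → (l , v) ∈ ps
lookupL-sound ((a , b) ∷ ps) {l} q with a ≟ l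
lookupL-sound ((a , b) ∷ ps) {l} refl | yes refl = here refl
... | no _ = there (lookupL-sound ps q)

Functional : List (ℕ × ℕ) → Set
Functional ps = ∀ {a b b′} → (a , b) ∈ ps → (a , b′) ∈ ps → b ≡ b′

lookupL-complete : ∀ ps {l v} → Functional ps → (l , v) ∈ ps → lookupL ps l ≡ just v
lookupL-complete ((a , b) ∷ ps) {l} F m with a ≟ l
lookupL-complete ((a , b) ∷ ps) {l} F m | yes refl = cong just (F (here refl) m)
lookupL-complete ((a , b) ∷ ps) {l} F (here refl) | no a≢l = ⊥-elim (a≢l refl)
lookupL-complete ((a , b) ∷ ps) {l} F (there m) | no a≢l = lookupL-complete ps (λ m₁ m₂ → F (there m₁) (there m₂)) m

lookupL-defined : ∀ ps {l v} → (l , v) ∈ ps → ∃ λ w → lookupL ps l ≡ just w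
lookupL-defined ((a , b) ∷ ps) {l} m with a ≟ l
... | yes _ = b , refl
lookupL-defined ((a , b) ∷ ps) {l} (here refl) | no a≢l = ⊥-elim (a≢l refl)
lookupL-defined ((a , b) ∷ ps) {l} (there m) | no a≢l = lookupL-defined ps m

lookupL-++ : ∀ ps qs l → lookupL (ps ++ qs) l ≡ merge (lookupL ps l) (lookupL qs l)
lookupL-++ [] qs l = refl
lookupL-++ ((a , b) ∷ ps) qs l with a ≟ l
... | yes _ = refl
... | no _ = lookupL-++ ps qs l

lastL-++ : ∀ a us vs → lastL a (us ++ vs) ≡ lastL (lastL a us) vs
lastL-++ a [] vs = refl
lastL-++ a (u ∷ us) vs = lastL-++ u us vs

true≢false : true ≡ false → ⊥
true≢false ()

Maybe-ext : ∀ {x y : Maybe ℕ} → (∀ v → x ≡ just v → y ≡ just v) → (∀ v → y ≡ just v → x ≡ just v) → x ≡ y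
Maybe-ext {just x} f g = sym (f x refl)
Maybe-ext {nothing} {just y} f g = g y refl
Maybe-ext {nothing} {nothing} f g = refl

Unique-++-disjoint : ∀ {A : Set} (xs : List A) {ys x} → Unique (xs ++ ys) → x ∈ xs → x ∈ ys → ⊥
Unique-++-disjoint (x ∷ xs) (a ∷ u) (here refl) m₂ = All.lookup a (∈-++⁺ʳ xs m₂) refl
Unique-++-disjoint (x ∷ xs) (a ∷ u) (there m₁) m₂ = Unique-++-disjoint xs u m₁ m₂

Unique-++ˡ : ∀ {A : Set} (xs : List A) {ys} → Unique (xs ++ ys) → Unique xs
Unique-++ˡ [] u = []
Unique-++ˡ (x ∷ xs) (a ∷ u) = All.tabulate (λ m → All.lookup a (∈-++⁺ˡ m)) ∷ Unique-++ˡ xs u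

Unique-++ʳ : ∀ {A : Set} (xs : List A) {ys} → Unique (xs ++ ys) → Unique ys
Unique-++ʳ [] u = u
Unique-++ʳ (x ∷ xs) (a ∷ u) = Unique-++ʳ xs u

length≡0⇒[] : ∀ {A : Set} (xs : List A) → length xs ≡ 0 → xs ≡ []
length≡0⇒[] [] _ = refl

maximum : List ℕ → ℕ
maximum = foldr _⊔_ 0

≤-maximum : ∀ {x} xs → x ∈ xs → x ≤ maximum xs
≤-maximum (y ∷ ys) (here refl) = m≤m⊔n y (maximum ys)
≤-maximum (y ∷ ys) (there m) = ≤-trans (≤-maximum ys m) (m≤n⊔m y (maximum ys))

≡ᵇ0⇒≡0 : ∀ n → (n ≡ᵇ 0) ≡ true → n ≡ 0
≡ᵇ0⇒≡0 zero _ = refl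

null⇒≡[] : ∀ {A : Set} (T : List A) → null T ≡ true → T ≡ []
null⇒≡[] [] _ = refl

⌊⌋-⇔ : ∀ {P Q : Set} → (P → Q) → (Q → P) → (P? : Dec P) (Q? : Dec Q) → ⌊ P? ⌋ ≡ ⌊ Q? ⌋
⌊⌋-⇔ f g (yes p) (yes q) = refl
⌊⌋-⇔ f g (yes p) (no ¬q) = ⊥-elim (¬q (f p))
⌊⌋-⇔ f g (no ¬p) (yes q) = ⊥-elim (¬p (g q))
⌊⌋-⇔ f g (no ¬p) (no ¬q) = refl

not-∨-false : ∀ a {b} → not a ∨ b ≡ false → a ≡ true × b ≡ false
not-∨-false true q = refl , q

not-∨-true : ∀ {a b} → a ≡ true → not a ∨ b ≡ true → b ≡ true
not-∨-true refl q = q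

dec-true⁻ : ∀ {P : Set} (d : Dec P) → ⌊ d ⌋ ≡ true → P
dec-true⁻ (yes p) _ = p
dec-true⁻ (no _) ()

dec-true⁺ : ∀ {P : Set} (d : Dec P) → P → ⌊ d ⌋ ≡ true
dec-true⁺ (yes _) _ = refl
dec-true⁺ (no np) p = ⊥-elim (np p)

module _ {A : Set} {P : A → Set} (P? : ∀ x → Dec (P x)) where
  partition-with : (xs : List A) → ∃₂ λ ys zs → Interleaving ys zs xs × (∀ {y} → y ∈ ys → P y) × (∀ {z} → z ∈ zs → ¬ P z)
  partition-with [] = [] , [] , [] , (λ ()) , (λ ())
  partition-with (x ∷ xs) with partition-with xs | P? x
  ... | ys , zs , i , f , g | yes p = x ∷ ys , zs , consˡ i , (λ { (here refl) → p ; (there m) → f m }) , g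
  ... | ys , zs , i , f , g | no np = ys , x ∷ zs , consʳ i , f , (λ { (here refl) → np ; (there m) → g m })

-- Abstract states and their semantics

-- Over N variables: ptr i j is a single cell from the value of i to that of j, seg i j a list
-- segment of at least two cells between them through unnamed locations, and garbage S any other
-- chunk, which allocates exactly the values of the variables in S.
data ChunkType (N : ℕ) : Set where
  ptr seg : Fin N → Fin N → ChunkType N
  garbage : Vec Bool N → ChunkType N

data IForm (N : ℕ) : Set where
  empᴵ : IForm N
  ptsᴵ lsᴵ eqᴵ neqᴵ : Fin N → Fin N → IForm N
  _⋆ᴵ_ _-⊛ᴵ_ _∧ᴵ_ _∨ᴵ_ : IForm N → IForm N → IForm N
  ¬ᴵ_ : IForm N → IForm N

-- Numbers of anonymous chunks from this bound on are indistinguishable to the formula (sat-stable).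
bound : ∀ {N} → IForm N → ℕ
bound (a ⋆ᴵ b) = bound a + bound b
bound (a -⊛ᴵ b) = bound b
bound (a ∧ᴵ b) = bound a ⊔ bound b
bound (a ∨ᴵ b) = bound a ⊔ bound b
bound (¬ᴵ a) = bound a
bound _ = 1

allVecs : ∀ {A : Set} → List A → (k : ℕ) → List (Vec A k)
allVecs U zero = [] ∷ []
allVecs U (suc k) = concatMap (λ x → map (x ∷_) (allVecs U k)) U

∈-allVecs : ∀ {A : Set} {U : List A} → (∀ x → x ∈ U) → ∀ {k} (v : Vec A k) → v ∈ allVecs U k
∈-allVecs cU [] = here refl
∈-allVecs {U = U} cU {suc k} (x ∷ v) =
  ∈-concatMap⁺ (λ x → map (x ∷_) (allVecs U k)) (Any.map (λ { refl → ∈-map⁺ (x ∷_) (∈-allVecs cU v) }) (cU x))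

booleans : List Bool
booleans = true ∷ false ∷ []

∈-booleans : ∀ b → b ∈ booleans
∈-booleans true = here refl
∈-booleans false = there (here refl)

allChunkTypes : (N : ℕ) → List (ChunkType N)
allChunkTypes N = cartesianProductWith ptr (allFin N) (allFin N) ++
                  (cartesianProductWith seg (allFin N) (allFin N) ++ map garbage (allVecs booleans N))

∈-allChunkTypes : ∀ {N} (t : ChunkType N) → t ∈ allChunkTypes N
∈-allChunkTypes (ptr i j) = ∈-++⁺ˡ (∈-cartesianProductWith⁺ ptr (∈-allFin i) (∈-allFin j))
∈-allChunkTypes {N} (seg i j) =
  ∈-++⁺ʳ (cartesianProductWith ptr (allFin N) (allFin N)) (∈-++⁺ˡ (∈-cartesianProductWith⁺ seg (∈-allFin i) (∈-allFin j)))
∈-allChunkTypes {N} (garbage S) =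
  ∈-++⁺ʳ (cartesianProductWith ptr (allFin N) (allFin N))
    (∈-++⁺ʳ (cartesianProductWith seg (allFin N) (allFin N)) (∈-map⁺ garbage (∈-allVecs ∈-booleans S)))

lists≤ : ∀ {A : Set} → ℕ → List A → List (List A)
lists≤ zero U = [] ∷ []
lists≤ (suc k) U = [] ∷ concatMap (λ x → map (x ∷_) (lists≤ k U)) U

∈-lists≤ : ∀ {A : Set} {U : List A} → (∀ x → x ∈ U) → ∀ k (l : List A) → length l ≤ k → l ∈ lists≤ k U
∈-lists≤ cU zero [] _ = here refl
∈-lists≤ cU (suc k) [] _ = here refl
∈-lists≤ {U = U} cU (suc k) (x ∷ l) (s≤s le) =
  there (∈-concatMap⁺ (λ x → map (x ∷_) (lists≤ k U)) (Any.map (λ { refl → ∈-map⁺ (x ∷_) (∈-lists≤ cU k l le) }) (cU x)))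

range : ℕ → List ℕ
range n = upTo (suc n)

∈-range⁺ : ∀ {k n} → k ≤ n → k ∈ range n
∈-range⁺ k≤n = ∈-upTo⁺ (s≤s k≤n)

∈-range⁻ : ∀ {k n} → k ∈ range n → k ≤ n
∈-range⁻ m = s≤s⁻¹ (∈-upTo⁻ m)

-- A heap is abstracted by the list of types of its chunks that allocate some variable's value and
-- the number of its remaining, anonymous chunks.
module Abstract {N : ℕ} (aliasing : Vec (Vec Bool N) N) (nilIx : Fin N) where

  _≈ᵇ_ : Fin N → Fin N → Bool
  i ≈ᵇ j = lookup (lookup aliasing i) j

  allocates : ChunkType N → Fin N → Bool
  allocates (ptr i j) k = i ≈ᵇ k
  allocates (seg i j) k = i ≈ᵇ k
  allocates (garbage S) k = any (λ m → lookup S m ∧ (m ≈ᵇ k)) (allFin N)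

  allocated : List (ChunkType N) → Fin N → Bool
  allocated T k = any (λ t → allocates t k) T

  disjoint : List (ChunkType N) → List (ChunkType N) → Bool
  disjoint T T′ = all (λ k → not (allocated T k ∧ allocated T′ k)) (allFin N)

  nonempty : ChunkType N → Bool
  nonempty (garbage S) = any (lookup S) (allFin N)
  nonempty _ = true

  consistent : List (ChunkType N) → Bool
  consistent [] = true
  consistent (t ∷ T) = nonempty t ∧ (disjoint (t ∷ []) T ∧ consistent T)

  nilFree : List (ChunkType N) → Bool
  nilFree T = not (allocated T nilIx)

  -- chain f T i j: the chunks T line up as segments from i to j; f is fuel, length T suffices.
  mutual
    chain : ℕ → List (ChunkType N) → Fin N → Fin N → Bool
    chain f [] i j = i ≈ᵇ j
    chain zero (_ ∷ _) i j = false
    chain (suc f) (t ∷ T) i j = any (λ p → chainStep f (proj₁ p) (proj₂ p) i j) (picks (t ∷ T))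

    chainStep : ℕ → ChunkType N → List (ChunkType N) → Fin N → Fin N → Bool
    chainStep f (ptr a c) R i j = (a ≈ᵇ i) ∧ (not (allocated R i) ∧ chain f R c j)
    chainStep f (seg a c) R i j = (a ≈ᵇ i) ∧ (not (allocated R i) ∧ chain f R c j)
    chainStep f (garbage _) R i j = false

  isPtr : List (ChunkType N) → Fin N → Fin N → Bool
  isPtr (ptr i j ∷ []) x y = (i ≈ᵇ x) ∧ (j ≈ᵇ y)
  isPtr _ x y = false

  candidates : List (List (ChunkType N))
  candidates = lists≤ N (allChunkTypes N)

  sat : List (ChunkType N) → ℕ → IForm N → Bool
  sat T n empᴵ = (n ≡ᵇ 0) ∧ null T
  sat T n (ptsᴵ x y) = (n ≡ᵇ 0) ∧ isPtr T x y
  sat T n (lsᴵ x y) = (n ≡ᵇ 0) ∧ chain (length T) T x y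
  sat T n (eqᴵ x y) = (n ≡ᵇ 0) ∧ (null T ∧ (x ≈ᵇ y))
  sat T n (neqᴵ x y) = (n ≡ᵇ 0) ∧ (null T ∧ not (x ≈ᵇ y))
  sat T n (a ⋆ᴵ b) = any (λ p → any (λ k → sat (proj₁ p) k a ∧ sat (proj₂ p) (n ∸ k) b) (range n)) (splits T)
  sat T n (a -⊛ᴵ b) = any (λ T′ → any
      (λ m → consistent T′ ∧ (nilFree T′ ∧ (disjoint T T′ ∧ (sat T′ m a ∧ sat (T ++ T′) (n + m) b))))
                                     (range (bound a + bound b))) candidates
  sat T n (a ∧ᴵ b) = sat T n a ∧ sat T n b
  sat T n (a ∨ᴵ b) = sat T n a ∨ sat T n b
  sat T n (¬ᴵ a) = not (sat T n a)

  private
    atom-unsat : ∀ {n} (b : Bool) → 1 ≤ n → (n ≡ᵇ 0) ∧ b ≡ false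
    atom-unsat b (s≤s z≤n) = refl

    any-cong : ∀ {A : Set} {p q : A → Bool} xs → (∀ x → p x ≡ q x) → any p xs ≡ any q xs
    any-cong [] h = refl
    any-cong (x ∷ xs) h = cong₂ _∨_ (h x) (any-cong xs h)

    bool-ext : ∀ {a b : Bool} → (a ≡ true → b ≡ true) → (b ≡ true → a ≡ true) → a ≡ b
    bool-ext {true} f g = sym (f refl)
    bool-ext {false} {true} f g = g refl
    bool-ext {false} {false} f g = refl

  mutual
    sat-stable : ∀ φ T {n n′} → bound φ ≤ n → bound φ ≤ n′ → sat T n φ ≡ sat T n′ φ
    sat-stable empᴵ T le le′ = trans (atom-unsat (null T) le) (sym (atom-unsat (null T) le′))
    sat-stable (ptsᴵ x y) T le le′ = trans (atom-unsat _ le) (sym (atom-unsat _ le′))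
    sat-stable (lsᴵ x y) T le le′ = trans (atom-unsat _ le) (sym (atom-unsat _ le′))
    sat-stable (eqᴵ x y) T le le′ = trans (atom-unsat _ le) (sym (atom-unsat _ le′))
    sat-stable (neqᴵ x y) T le le′ = trans (atom-unsat _ le) (sym (atom-unsat _ le′))
    sat-stable (a ⋆ᴵ b) T le le′ = bool-ext (⋆-stable a b T le le′) (⋆-stable a b T le′ le)
    sat-stable (a -⊛ᴵ b) T {n} {n′} le le′ =
      any-cong candidates (λ T′ → any-cong (range (bound a + bound b)) (λ m →
        cong (λ z → consistent T′ ∧ (nilFree T′ ∧ (disjoint T T′ ∧ (sat T′ m a ∧ z))))
          (sat-stable b (T ++ T′) (≤-trans le (m≤m+n n m)) (≤-trans le′ (m≤m+n n′ m)))))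
    sat-stable (a ∧ᴵ b) T le le′ = cong₂ _∧_ (sat-stable a T (m⊔n≤o⇒m≤o _ _ le) (m⊔n≤o⇒m≤o _ _ le′))
                                             (sat-stable b T (m⊔n≤o⇒n≤o _ _ le) (m⊔n≤o⇒n≤o _ _ le′))
    sat-stable (a ∨ᴵ b) T le le′ = cong₂ _∨_ (sat-stable a T (m⊔n≤o⇒m≤o _ _ le) (m⊔n≤o⇒m≤o _ _ le′))
                                             (sat-stable b T (m⊔n≤o⇒n≤o _ _ le) (m⊔n≤o⇒n≤o _ _ le′))
    sat-stable (¬ᴵ a) T le le′ = cong not (sat-stable a T le le′)

    -- A split k + (n ∸ k) of n is moved to one of n′ that keeps each part below its bound or unchanged.
    ⋆-stable : ∀ a b T {n n′} → bound a + bound b ≤ n → bound a + bound b ≤ n′ →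
               sat T n (a ⋆ᴵ b) ≡ true → sat T n′ (a ⋆ᴵ b) ≡ true
    ⋆-stable a b T {n} {n′} le le′ q with any-elim _ (splits T) q
    ... | (T₁ , T₂) , mT , q₂ with any-elim _ (range n) q₂
    ... | k , mk , q₃ with moved
      where
      A = bound a
      B = bound b
      moved : Σ ℕ λ k′ → k′ ≤ n′ × sat T₁ k a ≡ sat T₁ k′ a × sat T₂ (n ∸ k) b ≡ sat T₂ (n′ ∸ k′) b
      moved with k <? A
      ... | yes k<A = k , ≤-trans (<⇒≤ k<A) (m+n≤o⇒m≤o A le′) , refl ,
             sat-stable b T₂ (m+n≤o⇒m≤o∸n B (≤-trans (≤-trans (+-monoʳ-≤ B (<⇒≤ k<A)) (≤-reflexive (+-comm B A))) le))
                             (m+n≤o⇒m≤o∸n B (≤-trans (≤-trans (+-monoʳ-≤ B (<⇒≤ k<A)) (≤-reflexive (+-comm B A))) le′))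
      ... | no k≮A with (n ∸ k) <? B
      ... | yes r<B = n′ ∸ (n ∸ k) , m∸n≤m n′ (n ∸ k) ,
             sat-stable a T₁ (≮⇒≥ k≮A) (m+n≤o⇒m≤o∸n A (≤-trans (+-monoʳ-≤ A (<⇒≤ r<B)) le′)) ,
             cong (λ z → sat T₂ z b) (sym (m∸[m∸n]≡n (≤-trans (<⇒≤ r<B) (m+n≤o⇒n≤o A le′))))
      ... | no r≮B = A , m+n≤o⇒m≤o A le′ , sat-stable a T₁ (≮⇒≥ k≮A) ≤-refl ,
             sat-stable b T₂ (≮⇒≥ r≮B) (m+n≤o⇒m≤o∸n B (≤-trans (≤-reflexive (+-comm B A)) le′))
    ... | k′ , k′≤n′ , eqa , eqb =
      any-intro _ mT (any-intro _ (∈-range⁺ k′≤n′)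
        (∧-intro (trans (sym eqa) (∧-elimˡ _ q₃)) (trans (sym eqb) (∧-elimʳ (sat T₁ k a) q₃))))

  sat-clamp : ∀ φ T n {B} → bound φ ≤ B → sat T n φ ≡ sat T (n ⊓ B) φ
  sat-clamp φ T n {B} bφ≤B with n ≤? B
  ... | yes n≤B = cong (λ z → sat T z φ) (sym (m≤n⇒m⊓n≡m n≤B))
  ... | no n≰B = sat-stable φ T (≤-trans bφ≤B B≤n) (subst (bound φ ≤_) (sym (m≥n⇒m⊓n≡n B≤n)) bφ≤B)
    where
    B≤n : B ≤ n
    B≤n = <⇒≤ (≰⇒> n≰B)

-- Heaps as edge lists, and chunks

Edge : Set
Edge = Loc × Loc

_≟ᴱ_ : DecidableEquality Edge
_≟ᴱ_ = ≡-dec _≟_ _≟_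

endpoints : Edge → List Loc
endpoints (a , b) = a ∷ b ∷ []

infix 4 _∈H_ _∈H?_
record _∈H_ (e : Edge) (h : Heap) : Set where
  constructor inH
  field unH : fn h (proj₁ e) ≡ just (proj₂ e)
open _∈H_ public

_∈H?_ : ∀ e h → Dec (e ∈H h)
(a , b) ∈H? h = map′ inH unH (Maybeₚ.≡-dec _≟_ (fn h a) (just b))

infix 4 _≅_
_≅_ : List Edge → List Edge → Set
g ≅ g′ = (∀ {e} → e ∈ g → e ∈ g′) × (∀ {e} → e ∈ g′ → e ∈ g)

sources : List Edge → List Loc
sources g = map proj₁ g

∈-sources⁻ : ∀ {x} g → x ∈ sources g → ∃ λ y → (x , y) ∈ g
∈-sources⁻ g m with ∈-map⁻ proj₁ m
... | (x , y) , m′ , refl = y , m′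

∈-sources⁺ : ∀ {x y} g → (x , y) ∈ g → x ∈ sources g
∈-sources⁺ g m = ∈-map⁺ proj₁ m

sources-cells : ∀ a us b → sources (cells a (us ++ b ∷ [])) ≡ a ∷ us
sources-cells a [] b = refl
sources-cells a (u ∷ us) b = cong (a ∷_) (sources-cells u us b)

cells-first : ∀ u us b → ∃ λ x → (u , x) ∈ cells u (us ++ b ∷ [])
cells-first u [] b = b , here refl
cells-first u (w ∷ ws) b = w , here refl

heapOf : List Edge → Heap
heapOf ps = record { fn = lookupL ps ; fin = sources ps , λ l v q → ∈-sources⁺ ps (lookupL-sound ps q) }

-- The type nothing marks an anonymous chunk, one that allocates no variable's value.
Chunk : ℕ → Set
Chunk N = List Edge × Maybe (ChunkType N)

types : ∀ {N} → List (Chunk N) → List (ChunkType N)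
types [] = []
types ((g , just t) ∷ Cs) = t ∷ types Cs
types ((g , nothing) ∷ Cs) = types Cs

anonymous : ∀ {N} → List (Chunk N) → ℕ
anonymous [] = 0
anonymous ((g , just t) ∷ Cs) = anonymous Cs
anonymous ((g , nothing) ∷ Cs) = suc (anonymous Cs)

types-++ : ∀ {N} (Cs Cs′ : List (Chunk N)) → types (Cs ++ Cs′) ≡ types Cs ++ types Cs′
types-++ [] Cs′ = refl
types-++ ((g , just t) ∷ Cs) Cs′ = cong (t ∷_) (types-++ Cs Cs′)
types-++ ((g , nothing) ∷ Cs) Cs′ = types-++ Cs Cs′

anonymous-++ : ∀ {N} (Cs Cs′ : List (Chunk N)) → anonymous (Cs ++ Cs′) ≡ anonymous Cs + anonymous Cs′
anonymous-++ [] Cs′ = refl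
anonymous-++ ((g , just t) ∷ Cs) Cs′ = anonymous-++ Cs Cs′
anonymous-++ ((g , nothing) ∷ Cs) Cs′ = cong suc (anonymous-++ Cs Cs′)

types-interleaving : ∀ {N} {Cs₁ Cs₂ Cs : List (Chunk N)} → Interleaving Cs₁ Cs₂ Cs →
                     Interleaving (types Cs₁) (types Cs₂) (types Cs)
types-interleaving [] = []
types-interleaving {Cs = (g , just t) ∷ _} (consˡ i) = consˡ (types-interleaving i)
types-interleaving {Cs = (g , nothing) ∷ _} (consˡ i) = types-interleaving i
types-interleaving {Cs = (g , just t) ∷ _} (consʳ i) = consʳ (types-interleaving i)
types-interleaving {Cs = (g , nothing) ∷ _} (consʳ i) = types-interleaving i

anonymous-interleaving : ∀ {N} {Cs₁ Cs₂ Cs : List (Chunk N)} → Interleaving Cs₁ Cs₂ Cs →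
                         anonymous Cs ≡ anonymous Cs₁ + anonymous Cs₂
anonymous-interleaving [] = refl
anonymous-interleaving {Cs = (g , just t) ∷ _} (consˡ i) = anonymous-interleaving i
anonymous-interleaving {Cs = (g , nothing) ∷ _} (consˡ i) = cong suc (anonymous-interleaving i)
anonymous-interleaving {Cs = (g , just t) ∷ _} (consʳ i) = anonymous-interleaving i
anonymous-interleaving {Cs₁ = Cs₁} {Cs₂ = _ ∷ Cs₂} {Cs = (g , nothing) ∷ _} (consʳ i) =
  trans (cong suc (anonymous-interleaving i)) (sym (+-suc (anonymous Cs₁) (anonymous Cs₂)))

interleaving-from-types : ∀ {N} (Cs : List (Chunk N)) {T₁ T₂} k → Interleaving T₁ T₂ (types Cs) → k ≤ anonymous Cs →
  ∃₂ λ Cs₁ Cs₂ → Interleaving Cs₁ Cs₂ Cs × types Cs₁ ≡ T₁ × types Cs₂ ≡ T₂ ×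
                 anonymous Cs₁ ≡ k × anonymous Cs₂ ≡ anonymous Cs ∸ k
interleaving-from-types [] zero [] z≤n = [] , [] , [] , refl , refl , refl , refl
interleaving-from-types ((g , just t) ∷ Cs) k (consˡ i) le with interleaving-from-types Cs k i le
... | Cs₁ , Cs₂ , j , a , b , c , d = (g , just t) ∷ Cs₁ , Cs₂ , consˡ j , cong (t ∷_) a , b , c , d
interleaving-from-types ((g , just t) ∷ Cs) k (consʳ i) le with interleaving-from-types Cs k i le
... | Cs₁ , Cs₂ , j , a , b , c , d = Cs₁ , (g , just t) ∷ Cs₂ , consʳ j , a , cong (t ∷_) b , c , d
interleaving-from-types ((g , nothing) ∷ Cs) zero i le with interleaving-from-types Cs zero i z≤n
... | Cs₁ , Cs₂ , j , a , b , c , d = Cs₁ , (g , nothing) ∷ Cs₂ , consʳ j , a , b , c , cong suc d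
interleaving-from-types ((g , nothing) ∷ Cs) (suc k) i (s≤s le) with interleaving-from-types Cs k i le
... | Cs₁ , Cs₂ , j , a , b , c , d = (g , nothing) ∷ Cs₁ , Cs₂ , consˡ j , a , b , cong suc c , d

aliasingOf : ∀ {N} → (Fin N → ℕ) → Vec (Vec Bool N) N
aliasingOf val = tabulate (λ i → tabulate (λ j → ⌊ val i ≟ val j ⌋))


endpoint-inLocs : ∀ {h e l} → e ∈H h → l ∈ endpoints e → inLocs h l
endpoint-inLocs {e = a , b} q (here refl) = inj₁ (b , unH q)
endpoint-inLocs {e = a , b} q (there (here refl)) = inj₂ (a , unH q)

inLocs⇒endpoint : ∀ {h l} → inLocs h l → ∃ λ e → e ∈H h × l ∈ endpoints e
inLocs⇒endpoint {l = l} (inj₁ (v , q)) = (l , v) , inH q , here refl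
inLocs⇒endpoint {l = l} (inj₂ (k , q)) = (k , l) , inH q , there (here refl)

chunkSources : ∀ {N} → List (Chunk N) → List Loc
chunkSources Cs = concatMap (λ c → sources (proj₁ c)) Cs

∈-chunkSources⁻ : ∀ {N} {l} (Cs : List (Chunk N)) → l ∈ chunkSources Cs → ∃ λ c → c ∈ Cs × ∃ λ v → (l , v) ∈ proj₁ c
∈-chunkSources⁻ Cs m with find (∈-concatMap⁻ (λ c → sources (proj₁ c)) {xs = Cs} m)
... | c , m₁ , m₂ = c , m₁ , ∈-sources⁻ (proj₁ c) m₂

∈-chunkSources⁺ : ∀ {N} {l v c} (Cs : List (Chunk N)) → c ∈ Cs → (l , v) ∈ proj₁ c → l ∈ chunkSources Cs
∈-chunkSources⁺ Cs m₁ m₂ = ∈-concatMap⁺ (λ c → sources (proj₁ c)) {xs = Cs} (Any.map (λ { refl → ∈-sources⁺ _ m₂ }) m₁)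

restrictFn : Heap → List Loc → Loc → Maybe Loc
restrictFn h Ls l with l ∈? Ls
... | yes _ = fn h l
... | no _ = nothing

restrict-just : ∀ h Ls {l v} → restrictFn h Ls l ≡ just v → l ∈ Ls × fn h l ≡ just v
restrict-just h Ls {l} q with l ∈? Ls
... | yes m = m , q

restrict-∈ : ∀ h Ls {l} → l ∈ Ls → restrictFn h Ls l ≡ fn h l
restrict-∈ h Ls {l} m with l ∈? Ls
... | yes _ = refl
... | no l∉Ls = ⊥-elim (l∉Ls m)

restrict-∉ : ∀ h Ls {l} → l ∉ Ls → restrictFn h Ls l ≡ nothing
restrict-∉ h Ls {l} l∉Ls with l ∈? Ls
... | yes m = ⊥-elim (l∉Ls m)
... | no _ = refl

restrict : Heap → List Loc → Heap
restrict h Ls = record { fn = restrictFn h Ls ; fin = Ls , λ l v q → proj₁ (restrict-just h Ls q) }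

unionH : Heap → Heap → Heap
unionH h₁ h₂ = record { fn = λ l → merge (fn h₁ l) (fn h₂ l) ; fin = proj₁ (fin h₁) ++ proj₁ (fin h₂) , in-support }
  where
  in-support : ∀ l v → merge (fn h₁ l) (fn h₂ l) ≡ just v → l ∈ proj₁ (fin h₁) ++ proj₁ (fin h₂)
  in-support l v q with fn h₁ l in eq
  ... | just w = ∈-++⁺ˡ (proj₂ (fin h₁) l w eq)
  ... | nothing = ∈-++⁺ʳ (proj₁ (fin h₁)) (proj₂ (fin h₂) l v q)

just≢nothing : ∀ {A : Set} {a : A} → just a ≡ nothing → ⊥
just≢nothing ()

sources-++ : ∀ ps qs → sources (ps ++ qs) ≡ sources ps ++ sources qs
sources-++ ps qs = map-++ proj₁ ps qs

Unique-sources⇒Functional : ∀ ps → Unique (sources ps) → Functional ps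
Unique-sources⇒Functional ((x , y) ∷ ps) u (here refl) (here refl) = refl
Unique-sources⇒Functional ((x , y) ∷ ps) (a ∷ u) (here refl) (there m) = ⊥-elim (All.lookup a (∈-sources⁺ ps m) refl)
Unique-sources⇒Functional ((x , y) ∷ ps) (a ∷ u) (there m) (here refl) = ⊥-elim (All.lookup a (∈-sources⁺ ps m) refl)
Unique-sources⇒Functional ((x , y) ∷ ps) (a ∷ u) (there m) (there m′) = Unique-sources⇒Functional ps u m m′

lookupL-∉ : ∀ ps {l} → l ∉ sources ps → lookupL ps l ≡ nothing
lookupL-∉ ps {l} nm with lookupL ps l in eq
... | nothing = refl
... | just v = ⊥-elim (nm (∈-sources⁺ ps (lookupL-sound ps eq)))

∈-cells-target : ∀ a vs {y x} → (y , x) ∈ cells a vs → x ∈ vs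
∈-cells-target a (v ∷ vs) (here refl) = here refl
∈-cells-target a (v ∷ vs) (there m) = there (∈-cells-target v vs m)

∈-cells-source : ∀ a vs {y x} → (y , x) ∈ cells a vs → y ≡ a ⊎ y ∈ vs
∈-cells-source a (v ∷ vs) (here refl) = inj₁ refl
∈-cells-source a (v ∷ vs) (there m) with ∈-cells-source v vs m
... | inj₁ e = inj₂ (here e)
... | inj₂ m₂ = inj₂ (there m₂)

∈-cells-rest : ∀ d rest {l} → l ∈ rest → l ∈ sources (cells d rest) ⊎ l ≡ lastL d rest
∈-cells-rest d (r ∷ []) (here refl) = inj₂ refl
∈-cells-rest d (r ∷ r′ ∷ rest) (here refl) = inj₁ (there (here refl))
∈-cells-rest d (r ∷ rest) (there m) with ∈-cells-rest r rest m
... | inj₁ m₂ = inj₁ (there m₂)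
... | inj₂ e = inj₂ e

cells-last : ∀ a us b → ∃ λ y → (y , b) ∈ cells a (us ++ b ∷ [])
cells-last a [] b = a , here refl
cells-last a (u ∷ us) b = let (y , m) = cells-last u us b in y , there m

lastL-snoc : ∀ a us b → lastL a (us ++ b ∷ []) ≡ b
lastL-snoc a us b = lastL-++ a us (b ∷ [])

images : Heap → List Loc → List Loc
images h [] = []
images h (k ∷ ks) with fn h k
... | nothing = images h ks
... | just v = v ∷ images h ks

∈-images : ∀ h ks {k l} → k ∈ ks → fn h k ≡ just l → l ∈ images h ks
∈-images h (k′ ∷ ks) m q with fn h k′ in eq
∈-images h (k′ ∷ ks) (here refl) q | just v = here (just-injective (trans (sym q) eq))
∈-images h (k′ ∷ ks) (there m) q | just v = there (∈-images h ks m q)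
∈-images h (k′ ∷ ks) (here refl) q | nothing = ⊥-elim (just≢nothing (trans (sym q) eq))
∈-images h (k′ ∷ ks) (there m) q | nothing = ∈-images h ks m q

module Indexing (xs : List Var) where

  ++-⊆ˡ : ∀ ys {zs} → ys ++ zs ⊆ xs → ys ⊆ xs
  ++-⊆ˡ ys p m = p (∈-++⁺ˡ m)

  ++-⊆ʳ : ∀ ys {zs} → ys ++ zs ⊆ xs → zs ⊆ xs
  ++-⊆ʳ ys p m = p (∈-++⁺ʳ ys m)

  indexForm : (φ : Form) → fv φ ⊆ xs → IForm (length xs)
  indexForm emp p = empᴵ
  indexForm (x ↦ y) p = ptsᴵ (index (p (here refl))) (index (p (there (here refl))))
  indexForm (ls x y) p = lsᴵ (index (p (here refl))) (index (p (there (here refl))))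
  indexForm (x ≐ y) p = eqᴵ (index (p (here refl))) (index (p (there (here refl))))
  indexForm (x ≠ y) p = neqᴵ (index (p (here refl))) (index (p (there (here refl))))
  indexForm (φ ⋆ ψ) p = indexForm φ (++-⊆ˡ (fv φ) p) ⋆ᴵ indexForm ψ (++-⊆ʳ (fv φ) p)
  indexForm (φ -⊛ ψ) p = indexForm φ (++-⊆ˡ (fv φ) p) -⊛ᴵ indexForm ψ (++-⊆ʳ (fv φ) p)
  indexForm (φ ∧f ψ) p = indexForm φ (++-⊆ˡ (fv φ) p) ∧ᴵ indexForm ψ (++-⊆ʳ (fv φ) p)
  indexForm (φ ∨f ψ) p = indexForm φ (++-⊆ˡ (fv φ) p) ∨ᴵ indexForm ψ (++-⊆ʳ (fv φ) p)
  indexForm (¬f φ) p = ¬ᴵ (indexForm φ p)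

-- The chunk decomposition of the heaps over a fixed stack

module Concrete (xs : List Var) (val : Fin (length xs) → Loc) (s : Stack)
                (s-val : ∀ i → s (L.lookup xs i) ≡ just (val i))
                (s-dom : ∀ v l → s v ≡ just l → v ∈ xs) (nilIx : Fin (length xs)) where

  N : ℕ
  N = length xs

  Named : Loc → Set
  Named l = ∃ λ i → val i ≡ l

  Named? : ∀ l → Dec (Named l)
  Named? l = any? (λ i → val i ≟ l)

  imgS⇒Named : ∀ {l} → imgS s l → Named l
  imgS⇒Named {l} (x , q) with s-dom x l q
  ... | m = index m , just-injective (trans (sym (s-val (index m))) (trans (cong s (sym (lookup-index m))) q))

  Named⇒imgS : ∀ {l} → Named l → imgS s l
  Named⇒imgS (i , refl) = L.lookup xs i , s-val i

  -- Edges that no ⊎ˢ-decomposition can separate: they share a source, or an unnamed location.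
  Linked : Edge → Edge → Set
  Linked e e′ = (∃ λ l → l ∈ endpoints e × l ∈ endpoints e′ × ¬ Named l) ⊎ proj₁ e ≡ proj₁ e′

  Linked-sym : ∀ {e e′} → Linked e e′ → Linked e′ e
  Linked-sym (inj₁ (l , a , b , c)) = inj₁ (l , b , a , c)
  Linked-sym (inj₂ q) = inj₂ (sym q)

  Connected : List Edge → Set₁
  Connected g = ∀ (P : Edge → Set) → (∀ {e e′} → e ∈ g → e′ ∈ g → Linked e e′ → P e → P e′) →
                ∀ {e e′} → e ∈ g → e′ ∈ g → P e → P e′

  Connected-singleton : ∀ e → Connected (e ∷ [])
  Connected-singleton e P closed (here refl) (here refl) p = p

  Connected-cons : ∀ {x e₀ g′} → Connected g′ → e₀ ∈ g′ → Linked x e₀ → Connected (x ∷ g′)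
  Connected-cons {x} {e₀} {g′} connected-g′ e₀∈g′ x-e₀ P closed x∈ y∈ p = from-e₀ (to-e₀ x∈ p) y∈
    where
    closed′ : ∀ {a b} → a ∈ g′ → b ∈ g′ → Linked a b → P a → P b
    closed′ a∈g′ b∈g′ = closed (there a∈g′) (there b∈g′)
    to-e₀ : ∀ {z} → z ∈ x ∷ g′ → P z → P e₀
    to-e₀ (here refl) p = closed (here refl) (there e₀∈g′) x-e₀ p
    to-e₀ (there m) p = connected-g′ P closed′ m e₀∈g′ p
    from-e₀ : ∀ {y} → P e₀ → y ∈ x ∷ g′ → P y
    from-e₀ p (here refl) = closed (there e₀∈g′) (here refl) (Linked-sym x-e₀) p
    from-e₀ p (there m) = connected-g′ P closed′ e₀∈g′ m p

  Connected-merge : ∀ e gs → (∀ {g} → g ∈ gs → Connected g) → (∀ {g} → g ∈ gs → Any (Linked e) g) →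
                    Connected (e ∷ concat gs)
  Connected-merge e gs connected-gs linked-e P closed x∈ y∈ p = from-e (to-e x∈ p) y∈
    where
    closed′ : ∀ {g₀} → g₀ ∈ gs → ∀ {a b} → a ∈ g₀ → b ∈ g₀ → Linked a b → P a → P b
    closed′ g₀∈gs a∈g₀ b∈g₀ = closed (there (∈-concat⁺′ a∈g₀ g₀∈gs)) (there (∈-concat⁺′ b∈g₀ g₀∈gs))
    to-e : ∀ {x} → x ∈ e ∷ concat gs → P x → P e
    to-e (here refl) p = p
    to-e (there m) p with ∈-concat⁻′ gs m
    ... | g₀ , x∈g₀ , g₀∈gs with find (linked-e g₀∈gs)
    ... | e′ , e′∈g₀ , e-e′ = closed (there (∈-concat⁺′ e′∈g₀ g₀∈gs)) (here refl) (Linked-sym e-e′)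
                                 (connected-gs g₀∈gs P (closed′ g₀∈gs) x∈g₀ e′∈g₀ p)
    from-e : ∀ {y} → P e → y ∈ e ∷ concat gs → P y
    from-e p (here refl) = p
    from-e p (there m) with ∈-concat⁻′ gs m
    ... | g₀ , y∈g₀ , g₀∈gs with find (linked-e g₀∈gs)
    ... | e′ , e′∈g₀ , e-e′ = connected-gs g₀∈gs P (closed′ g₀∈gs) e′∈g₀ y∈g₀
                                 (closed (here refl) (there (∈-concat⁺′ e′∈g₀ g₀∈gs)) e-e′ p)

  cells-connected : ∀ a us b → All (λ u → ¬ Named u) us → Connected (cells a (us ++ b ∷ []))
  cells-connected a [] b _ = Connected-singleton _
  cells-connected a (u ∷ us) b (unnamed-u ∷ unnamed-us) with cells-first u us b
  ... | x , x∈ = Connected-cons (cells-connected u us b unnamed-us) x∈ (inj₁ (u , there (here refl) , here refl , unnamed-u))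

  Apart : List Edge → List Edge → Set
  Apart g g′ = ∀ {e e′} → e ∈ g → e′ ∈ g′ → ¬ Linked e e′

  Apart-sym : ∀ {g g′} → Apart g g′ → Apart g′ g
  Apart-sym sp m m′ lk = sp m′ m (Linked-sym lk)

  IsSegment : List Edge → Loc → Loc → List Loc → Set
  IsSegment g a b us = g ≅ cells a (us ++ b ∷ []) × All (λ u → ¬ Named u) us × Unique (a ∷ us) × Named a × Named b

  SegmentShaped : List Edge → Set
  SegmentShaped g = ∃ λ a → ∃ λ b → ∃ λ us → IsSegment g a b us

  HasType : List Edge → ChunkType N → Set
  HasType g (ptr i j) = IsSegment g (val i) (val j) []
  HasType g (seg i j) = ∃ λ u → ∃ λ us → IsSegment g (val i) (val j) (u ∷ us)
  HasType g (garbage S) = (∀ k → lookup S k ≡ true → val k ∈ sources g) ×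
                          (∀ k → val k ∈ sources g → ∃ λ m → lookup S m ≡ true × val m ≡ val k) ×
                          (∃ λ k → lookup S k ≡ true) × ¬ SegmentShaped g

  Classified : List Edge → Maybe (ChunkType N) → Set
  Classified g (just t) = HasType g t
  Classified g nothing = ∀ l → l ∈ sources g → ¬ Named l

  ChunksApart : Chunk N → Chunk N → Set
  ChunksApart x y = Apart (proj₁ x) (proj₁ y)

  record Decomposition (h : Heap) : Set₁ where
    field
      chunks : List (Chunk N)
      sound : ∀ {c e} → c ∈ chunks → e ∈ proj₁ c → e ∈H h
      complete : ∀ {e} → e ∈H h → ∃ λ c → c ∈ chunks × e ∈ proj₁ c
      inhabited : ∀ {c} → c ∈ chunks → ∃ λ e → e ∈ proj₁ c
      connected : ∀ {c} → c ∈ chunks → Connected (proj₁ c)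
      apart : AllPairs ChunksApart chunks
      classified : ∀ {c} → c ∈ chunks → Classified (proj₁ c) (proj₂ c)
  open Decomposition public

  chunk-of-component : ∀ {h} (d : Decomposition h) (G : List Edge) {e₀} → e₀ ∈ G → Connected G → (∀ {e} → e ∈ G → e ∈H h) →
    (∀ {e e′} → e ∈ G → e′ ∈H h → Linked e e′ → e′ ∈ G) → ∃ λ C → C ∈ chunks d × proj₁ C ≅ G
  chunk-of-component d G e₀∈G connected-G G⊆h G-closed with complete d (G⊆h e₀∈G)
  ... | C , C∈d , e₀∈C = C , C∈d ,
      (λ m → connected-C (λ e → e ∈ G) (λ a∈G b∈G linked e∈C → G-closed e∈C (sound d C∈d b∈G) linked) e₀∈C m e₀∈G) ,
                                     (λ m → connected-G (λ e → e ∈ proj₁ C) closed e₀∈G m e₀∈C)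
    where
    connected-C = connected d C∈d
    closed : ∀ {e e′} → e ∈ G → e′ ∈ G → Linked e e′ → e ∈ proj₁ C → e′ ∈ proj₁ C
    closed {e} {e′} a∈G b∈G linked e∈C with complete d (G⊆h b∈G)
    ... | C′ , C′∈d , e′∈C′ with ∈-AllPairs₂ (apart d) C∈d C′∈d
    ... | inj₁ refl = e′∈C′
    ... | inj₂ (inj₁ apart-CC′) = ⊥-elim (apart-CC′ e∈C e′∈C′ linked)
    ... | inj₂ (inj₂ apart-CC′) = ⊥-elim (apart-CC′ e′∈C′ e∈C (Linked-sym linked))

  open Abstract (aliasingOf val) nilIx public

  private
    ≈ᵇ-≡ : ∀ i j → i ≈ᵇ j ≡ ⌊ val i ≟ val j ⌋
    ≈ᵇ-≡ i j = trans (cong (λ v → lookup v j) (lookup∘tabulate _ i)) (lookup∘tabulate _ j)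

  ≈ᵇ⇒≡ : ∀ {i j} → i ≈ᵇ j ≡ true → val i ≡ val j
  ≈ᵇ⇒≡ {i} {j} q with val i ≟ val j | ≈ᵇ-≡ i j
  ... | yes p | _ = p
  ... | no _ | r = ⊥-elim (true≢false (trans (sym q) r))

  ≡⇒≈ᵇ : ∀ {i j} → val i ≡ val j → i ≈ᵇ j ≡ true
  ≡⇒≈ᵇ {i} {j} p with val i ≟ val j | ≈ᵇ-≡ i j
  ... | yes _ | r = r
  ... | no np | _ = ⊥-elim (np p)

  Compatible⇒¬Linked : ∀ {h₁ h₂ e e′} → Compatible s h₁ h₂ → e ∈H h₁ → e′ ∈H h₂ → ¬ Linked e e′
  Compatible⇒¬Linked (_ , shared⇒img) q q′ (inj₁ (l , m , m′ , l-unnamed)) =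
    l-unnamed (imgS⇒Named (shared⇒img l (endpoint-inLocs q m) (endpoint-inLocs q′ m′)))
  Compatible⇒¬Linked {e = a , b} {e′ = a′ , b′} (dom-disjoint , _) q q′ (inj₂ refl) =
    dom-disjoint a ((b , unH q) , (b′ , unH q′))

  ∈H-unionˡ : ∀ {h h₁ h₂ e} → IsUnionS s h h₁ h₂ → e ∈H h₁ → e ∈H h
  ∈H-unionˡ {e = a , b} (_ , f) (inH q) = inH (trans (f a) (cong (λ z → merge z _) q))

  ∈H-unionʳ : ∀ {h h₁ h₂ e} → IsUnionS s h h₁ h₂ → e ∈H h₂ → e ∈H h
  ∈H-unionʳ {h₁ = h₁} {e = a , b} (c , f) (inH q) with fn h₁ a in eq
  ... | just v = ⊥-elim (proj₁ c a ((v , eq) , (b , q)))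
  ... | nothing = inH (trans (f a) (trans (cong (λ z → merge z _) eq) q))

  ∈H-union⁻ : ∀ {h h₁ h₂ e} → IsUnionS s h h₁ h₂ → e ∈H h → e ∈H h₁ ⊎ e ∈H h₂
  ∈H-union⁻ {h₁ = h₁} {e = a , b} (_ , f) (inH q) with fn h₁ a in eq
  ... | just v = inj₁ (inH (trans eq (trans (sym (trans (f a) (cong (λ z → merge z _) eq))) q)))
  ... | nothing = inj₂ (inH (trans (sym (trans (f a) (cong (λ z → merge z _) eq))) q))

  subDecomposition : ∀ {h h′} (d : Decomposition h) {Cs Cs′} → Interleaving Cs Cs′ (chunks d) →
    (∀ {c e} → c ∈ Cs → e ∈ proj₁ c → e ∈H h′) → (∀ {e} → e ∈H h′ → ∃ λ c → c ∈ Cs × e ∈ proj₁ c) → Decomposition h′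
  subDecomposition d {Cs} i sd cp = record
    { chunks = Cs ; sound = sd ; complete = cp
    ; inhabited = λ m → inhabited d (∈-interleavingˡ i m) ; connected = λ m → connected d (∈-interleavingˡ i m)
    ; apart = proj₁ (AllPairs-interleaving⁻ i (apart d)) ; classified = λ m → classified d (∈-interleavingˡ i m) }

  module _ {h h₁ h₂ : Heap} (U : IsUnionS s h h₁ h₂) where

    -- A connected chunk cannot be cut by ⊎ˢ, so it lies in h₁ or in h₂ entirely.
    sortChunks : (Cs : List (Chunk N)) → (∀ {c} → c ∈ Cs → (∀ {e} → e ∈ proj₁ c → e ∈H h) × Connected (proj₁ c)) →
      ∃₂ λ Cs₁ Cs₂ → Interleaving Cs₁ Cs₂ Cs ×
                     (∀ {c e} → c ∈ Cs₁ → e ∈ proj₁ c → e ∈H h₁) × (∀ {c e} → c ∈ Cs₂ → e ∈ proj₁ c → e ∈H h₂)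
    sortChunks [] H = [] , [] , [] , (λ ()) , (λ ())
    sortChunks ((g , t) ∷ Cs) H with sortChunks Cs (λ m → H (there m)) | Any.any? (λ e → e ∈H? h₁) g
    ... | Cs₁ , Cs₂ , i , in₁ , in₂ | yes some-in-h₁ =
      (g , t) ∷ Cs₁ , Cs₂ , consˡ i , (λ { (here refl) m → all-in-h₁ m ; (there m₀) m → in₁ m₀ m }) , in₂
      where
      closed : ∀ {e e′} → e ∈ g → e′ ∈ g → Linked e e′ → e ∈H h₁ → e′ ∈H h₁
      closed {e′ = e′} _ m′ lk q with e′ ∈H? h₁
      ... | yes q′ = q′
      ... | no ¬q′ with ∈H-union⁻ {h} {h₁} {h₂} U (proj₁ (H (here refl)) m′)
      ... | inj₁ q₁ = ⊥-elim (¬q′ q₁)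
      ... | inj₂ q₂ = ⊥-elim (Compatible⇒¬Linked (proj₁ U) q q₂ lk)
      all-in-h₁ : ∀ {e} → e ∈ g → e ∈H h₁
      all-in-h₁ m = let (_ , m₀ , q₀) = find some-in-h₁ in proj₂ (H (here refl)) (λ e → e ∈H h₁) closed m₀ m q₀
    ... | Cs₁ , Cs₂ , i , in₁ , in₂ | no none-in-h₁ =
      Cs₁ , (g , t) ∷ Cs₂ , consʳ i , in₁ , (λ { (here refl) m → all-in-h₂ m ; (there m₀) m → in₂ m₀ m })
      where
      all-in-h₂ : ∀ {e} → e ∈ g → e ∈H h₂
      all-in-h₂ m with ∈H-union⁻ U (proj₁ (H (here refl)) m)
      ... | inj₁ q₁ = ⊥-elim (none-in-h₁ (Any.map (λ { refl → q₁ }) m))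
      ... | inj₂ q₂ = q₂

    splitDecomposition : (d : Decomposition h) →
      Σ (Decomposition h₁) λ d₁ → Σ (Decomposition h₂) λ d₂ → Interleaving (chunks d₁) (chunks d₂) (chunks d)
    splitDecomposition d with sortChunks (chunks d) (λ m → (λ m′ → sound d m m′) , connected d m)
    ... | Cs₁ , Cs₂ , i , in₁ , in₂ = subDecomposition d i in₁ complete₁ , subDecomposition d (swap i) in₂ complete₂ , i
      where
      complete₁ : ∀ {e} → e ∈H h₁ → ∃ λ c → c ∈ Cs₁ × e ∈ proj₁ c
      complete₁ q with complete d (∈H-unionˡ {h} {h₁} {h₂} U q)
      ... | c , m , me with ∈-interleaving⁻ i m
      ... | inj₁ m₁ = c , m₁ , me
      ... | inj₂ m₂ = ⊥-elim (Compatible⇒¬Linked (proj₁ U) q (in₂ m₂ me) (inj₂ refl))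
      complete₂ : ∀ {e} → e ∈H h₂ → ∃ λ c → c ∈ Cs₂ × e ∈ proj₁ c
      complete₂ q with complete d (∈H-unionʳ {h} {h₁} {h₂} U q)
      ... | c , m , me with ∈-interleaving⁻ i m
      ... | inj₂ m₂ = c , m₂ , me
      ... | inj₁ m₁ = ⊥-elim (Compatible⇒¬Linked (proj₁ U) (in₁ m₁ me) q (inj₂ refl))

  module _ {h : Heap} (d : Decomposition h) where

    apart-across : ∀ {Cs Cs′} → Interleaving Cs Cs′ (chunks d) → ∀ {c c′} → c ∈ Cs → c′ ∈ Cs′ → Apart (proj₁ c) (proj₁ c′)
    apart-across i = AllPairs-interleaving-across (λ {x} {y} → Apart-sym {proj₁ x} {proj₁ y}) i (apart d)

    restrictDecomposition : ∀ Cs Cs′ → Interleaving Cs Cs′ (chunks d) → Decomposition (restrict h (chunkSources Cs))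
    restrictDecomposition Cs Cs′ i = subDecomposition d i sd cp
      where
      Ls = chunkSources Cs
      sd : ∀ {c e} → c ∈ Cs → e ∈ proj₁ c → e ∈H restrict h Ls
      sd m me = inH (trans (restrict-∈ h Ls (∈-chunkSources⁺ Cs m me)) (unH (sound d (∈-interleavingˡ i m) me)))
      cp : ∀ {e} → e ∈H restrict h Ls → ∃ λ c → c ∈ Cs × e ∈ proj₁ c
      cp {a , b} (inH q) with restrict-just h Ls q
      ... | a∈Ls , q′ with complete d (inH {a , b} {h} q′)
      ... | c , m , me with ∈-interleaving⁻ i m
      ... | inj₁ m₁ = c , m₁ , me
      ... | inj₂ m₂ with ∈-chunkSources⁻ Cs a∈Ls
      ... | c₁ , m₁ , _ , me₁ = ⊥-elim (apart-across i m₁ m₂ me₁ me (inj₂ refl))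

    restrict-union : ∀ {Cs₁ Cs₂} → Interleaving Cs₁ Cs₂ (chunks d) →
                     IsUnionS s h (restrict h (chunkSources Cs₁)) (restrict h (chunkSources Cs₂))
    restrict-union {Cs₁} {Cs₂} i = (dom-disjoint , shared⇒img) , union
      where
      L₁ = chunkSources Cs₁
      L₂ = chunkSources Cs₂
      dom-disjoint : ∀ l → ¬ (inDom (restrict h L₁) l × inDom (restrict h L₂) l)
      dom-disjoint l ((_ , q₁) , (_ , q₂))
        with ∈-chunkSources⁻ Cs₁ (proj₁ (restrict-just h L₁ q₁)) | ∈-chunkSources⁻ Cs₂ (proj₁ (restrict-just h L₂ q₂))
      ... | _ , m₁ , _ , me₁ | _ , m₂ , _ , me₂ = apart-across i m₁ m₂ me₁ me₂ (inj₂ refl)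
      shared⇒img : ∀ l → inLocs (restrict h L₁) l → inLocs (restrict h L₂) l → imgS s l
      shared⇒img l il₁ il₂ with Named? l
      ... | yes named = Named⇒imgS named
      ... | no unnamed with inLocs⇒endpoint {restrict h L₁} il₁ | inLocs⇒endpoint {restrict h L₂} il₂
      ... | e₁ , q₁ , lm₁ | e₂ , q₂ , lm₂
        with complete (restrictDecomposition Cs₁ Cs₂ i) q₁ | complete (restrictDecomposition Cs₂ Cs₁ (swap i)) q₂
      ... | _ , m₁ , me₁ | _ , m₂ , me₂ = ⊥-elim (apart-across i m₁ m₂ me₁ me₂ (inj₁ (l , lm₁ , lm₂ , unnamed)))
      union : ∀ l → fn h l ≡ merge (restrictFn h L₁ l) (restrictFn h L₂ l)
      union l with l ∈? L₁
      ... | yes _ with fn h l in eq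
      ... | just v = refl
      ... | nothing with l ∈? L₂
      ... | yes _ = sym eq
      ... | no _ = refl
      union l | no l∉L₁ with l ∈? L₂
      ... | yes _ = refl
      ... | no l∉L₂ with fn h l in eq
      ... | nothing = refl
      ... | just v with complete d (inH {l , v} {h} eq)
      ... | c , m , me with ∈-interleaving⁻ i m
      ... | inj₁ m′ = ⊥-elim (l∉L₁ (∈-chunkSources⁺ Cs₁ m′ me))
      ... | inj₂ m′ = ⊥-elim (l∉L₂ (∈-chunkSources⁺ Cs₂ m′ me))

  unionDecomposition : ∀ {h h₁ h′} → Decomposition h → Decomposition h₁ → IsUnionS s h′ h h₁ → Decomposition h′
  unionDecomposition {h} {h₁} {h′} d d₁ U = record
    { chunks = chunks d ++ chunks d₁ ; sound = sd ; complete = cp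
    ; inhabited = λ m → either m (inhabited d) (inhabited d₁) ; connected = λ m → either m (connected d) (connected d₁)
    ; apart = AllPairs.++⁺ (apart d) (apart d₁) across ; classified = λ m → either m (classified d) (classified d₁) }
    where
    either : ∀ {ℓ} {P : Chunk N → Set ℓ} {c} → c ∈ chunks d ++ chunks d₁ →
             (∀ {c} → c ∈ chunks d → P c) → (∀ {c} → c ∈ chunks d₁ → P c) → P c
    either m f g with ∈-++⁻ (chunks d) m
    ... | inj₁ m₁ = f m₁
    ... | inj₂ m₂ = g m₂
    sd : ∀ {c e} → c ∈ chunks d ++ chunks d₁ → e ∈ proj₁ c → e ∈H h′
    sd m me with ∈-++⁻ (chunks d) m
    ... | inj₁ m₁ = ∈H-unionˡ {h′} {h} {h₁} U (sound d m₁ me)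
    ... | inj₂ m₂ = ∈H-unionʳ {h′} {h} {h₁} U (sound d₁ m₂ me)
    cp : ∀ {e} → e ∈H h′ → ∃ λ c → c ∈ chunks d ++ chunks d₁ × e ∈ proj₁ c
    cp q with ∈H-union⁻ {h′} {h} {h₁} U q
    ... | inj₁ q₁ = let (c , m , me) = complete d q₁ in c , ∈-++⁺ˡ m , me
    ... | inj₂ q₂ = let (c , m , me) = complete d₁ q₂ in c , ∈-++⁺ʳ (chunks d) m , me
    across : All (λ x → All (ChunksApart x) (chunks d₁)) (chunks d)
    across = All.tabulate (λ m → All.tabulate (λ m₁ me me₁ → Compatible⇒¬Linked (proj₁ U) (sound d m me) (sound d₁ m₁ me₁)))

  sources-mono : ∀ {x g g′} → (∀ {e} → e ∈ g′ → e ∈ g) → x ∈ sources g′ → x ∈ sources g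
  sources-mono {g = g} {g′} f m = let (_ , m′) = ∈-sources⁻ g′ m in ∈-sources⁺ g (f m′)

  Apart⇒sources-disjoint : ∀ {g g′ l} → Apart g g′ → l ∈ sources g → l ∈ sources g′ → ⊥
  Apart⇒sources-disjoint {g} {g′} apart-gg′ m m′ =
    let (_ , me) = ∈-sources⁻ g m ; (_ , me′) = ∈-sources⁻ g′ m′ in apart-gg′ me me′ (inj₂ refl)

  IsSegment-named-source : ∀ {g a b us x} → IsSegment g a b us → Named x → x ∈ sources g → x ≡ a
  IsSegment-named-source {g} {a} {b} {us} (g≅path , unnamed-us , _) named-x m with ∈-sources⁻ g m
  ... | _ , m′ with subst (_ ∈_) (sources-cells a us b) (∈-sources⁺ _ (proj₁ g≅path m′))
  ... | here x≡a = x≡a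
  ... | there x∈us = ⊥-elim (All.lookup unnamed-us x∈us named-x)

  IsSegment-start : ∀ {g a b us} → IsSegment g a b us → a ∈ sources g
  IsSegment-start {g} {a} {b} {us} (g≅path , _) = sources-mono (proj₂ g≅path)
      (subst (a ∈_) (sym (sources-cells a us b)) (here refl))

  HasType-named-source : ∀ {g} t → HasType g t → ∃ λ k → val k ∈ sources g
  HasType-named-source (ptr i j) w = i , IsSegment-start w
  HasType-named-source (seg i j) (_ , _ , w) = i , IsSegment-start w
  HasType-named-source (garbage S) (members-sources , _ , (k , k∈S) , _) = k , members-sources k k∈S

  allocates-correct : ∀ {g} t k → HasType g t → (allocates t k ≡ true → val k ∈ sources g) ×
      (val k ∈ sources g → allocates t k ≡ true)
  allocates-correct (ptr i j) k w =
    (λ q → subst (_∈ sources _) (≈ᵇ⇒≡ q) (IsSegment-start w)) , λ m → ≡⇒≈ᵇ (sym (IsSegment-named-source w (k , refl) m))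
  allocates-correct (seg i j) k (_ , _ , w) =
    (λ q → subst (_∈ sources _) (≈ᵇ⇒≡ q) (IsSegment-start w)) , λ m → ≡⇒≈ᵇ (sym (IsSegment-named-source w (k , refl) m))
  allocates-correct {g} (garbage S) k (members-sources , sources-members , _) = to-sources , from-sources
    where
    to-sources : allocates (garbage S) k ≡ true → val k ∈ sources g
    to-sources q with any-elim (λ m → lookup S m ∧ (m ≈ᵇ k)) (allFin N) q
    ... | m , _ , q′ = subst (_∈ sources g) (≈ᵇ⇒≡ (∧-elimʳ (lookup S m) q′)) (members-sources m (∧-elimˡ (lookup S m) q′))
    from-sources : val k ∈ sources g → allocates (garbage S) k ≡ true
    from-sources m = let (m′ , m′∈S , e) = sources-members k m in
      any-intro (λ m → lookup S m ∧ (m ≈ᵇ k)) (∈-allFin m′) (∧-intro m′∈S (≡⇒≈ᵇ e))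

  AllClassified : List (Chunk N) → Set
  AllClassified Cs = ∀ {C} → C ∈ Cs → Classified (proj₁ C) (proj₂ C)

  allocated-chunks : ∀ (Cs : List (Chunk N)) k → AllClassified Cs →
    (allocated (types Cs) k ≡ true → ∃ λ C → C ∈ Cs × val k ∈ sources (proj₁ C)) ×
    ((∃ λ C → C ∈ Cs × val k ∈ sources (proj₁ C)) → allocated (types Cs) k ≡ true)
  allocated-chunks [] k cl = (λ ()) , λ { (_ , () , _) }
  allocated-chunks ((g , just t) ∷ Cs) k cl = to-chunk , from-chunk
    where
    ih = allocated-chunks Cs k (λ m → cl (there m))
    to-chunk : allocated (t ∷ types Cs) k ≡ true → ∃ λ C → C ∈ (g , just t) ∷ Cs × val k ∈ sources (proj₁ C)
    to-chunk q with ∨-elim (allocates t k) q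
    ... | inj₁ q₁ = (g , just t) , here refl , proj₁ (allocates-correct t k (cl (here refl))) q₁
    ... | inj₂ q₂ = let (C , m , k∈C) = proj₁ ih q₂ in C , there m , k∈C
    from-chunk : (∃ λ C → C ∈ (g , just t) ∷ Cs × val k ∈ sources (proj₁ C)) → allocated (t ∷ types Cs) k ≡ true
    from-chunk (_ , here refl , k∈g) = ∨-introˡ (allocated (types Cs) k) (proj₂ (allocates-correct t k (cl (here refl))) k∈g)
    from-chunk (C , there m , k∈C) = ∨-introʳ (allocates t k) (proj₂ ih (C , m , k∈C))
  allocated-chunks ((g , nothing) ∷ Cs) k cl = to-chunk , from-chunk
    where
    ih = allocated-chunks Cs k (λ m → cl (there m))
    to-chunk : allocated (types Cs) k ≡ true → ∃ λ C → C ∈ (g , nothing) ∷ Cs × val k ∈ sources (proj₁ C)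
    to-chunk q = let (C , m , k∈C) = proj₁ ih q in C , there m , k∈C
    from-chunk : (∃ λ C → C ∈ (g , nothing) ∷ Cs × val k ∈ sources (proj₁ C)) → allocated (types Cs) k ≡ true
    from-chunk (_ , here refl , k∈g) = ⊥-elim (cl (here refl) (val k) k∈g (k , refl))
    from-chunk (C , there m , k∈C) = proj₂ ih (C , m , k∈C)

  allocated-correct : ∀ {h} (d : Decomposition h) k →
    (allocated (types (chunks d)) k ≡ true → inDom h (val k)) × (inDom h (val k) → allocated (types (chunks d)) k ≡ true)
  allocated-correct {h} d k = to-dom , from-dom
    where
    to-dom : allocated (types (chunks d)) k ≡ true → inDom h (val k)
    to-dom q with proj₁ (allocated-chunks (chunks d) k (classified d)) q
    ... | C , m , k∈C with ∈-sources⁻ (proj₁ C) k∈C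
    ... | v , me = v , unH (sound d m me)
    from-dom : inDom h (val k) → allocated (types (chunks d)) k ≡ true
    from-dom (v , q) with complete d (inH {val k , v} {h} q)
    ... | C , m , me = proj₂ (allocated-chunks (chunks d) k (classified d)) (C , m , ∈-sources⁺ (proj₁ C) me)

  consistent-chunks : ∀ (Cs : List (Chunk N)) → AllPairs ChunksApart Cs → AllClassified Cs → consistent (types Cs) ≡ true
  consistent-chunks [] _ _ = refl
  consistent-chunks ((g , nothing) ∷ Cs) (_ ∷ apart-Cs) cl = consistent-chunks Cs apart-Cs (λ m → cl (there m))
  consistent-chunks ((g , just t) ∷ Cs) (apart-g ∷ apart-Cs) cl =
    ∧-intro (nonempty-t t (cl (here refl))) (∧-intro disjoint-t (consistent-chunks Cs apart-Cs (λ m → cl (there m))))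
    where
    nonempty-t : ∀ t → HasType g t → nonempty t ≡ true
    nonempty-t (ptr i j) _ = refl
    nonempty-t (seg i j) _ = refl
    nonempty-t (garbage S) (_ , _ , (k , k∈S) , _) = any-intro (lookup S) (∈-allFin k) k∈S
    disjoint-t : disjoint (t ∷ []) (types Cs) ≡ true
    disjoint-t = all-intro _ (allFin N)
        (λ k _ → not-intro _ (λ q → clash k (∧-elimˡ (allocated (t ∷ []) k) q) (∧-elimʳ (allocated (t ∷ []) k) q)))
      where
      clash : ∀ k → allocated (t ∷ []) k ≡ true → allocated (types Cs) k ≡ true → ⊥
      clash k q₁ q₂ with proj₁ (allocated-chunks Cs k (λ m → cl (there m))) q₂ | ∨-elim (allocates t k) q₁
      ... | C , m , k∈C | inj₁ k∈t =
        Apart⇒sources-disjoint (All.lookup apart-g m) (proj₁ (allocates-correct t k (cl (here refl))) k∈t) k∈C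

  consistent-correct : ∀ {h} (d : Decomposition h) → consistent (types (chunks d)) ≡ true
  consistent-correct d = consistent-chunks (chunks d) (apart d) (classified d)

  nilFree-correct : ∀ {h} (d : Decomposition h) → L.lookup xs nilIx ≡ nil → IsModel s h → nilFree (types (chunks d)) ≡ true
  nilFree-correct {h} d nilIx-nil (n , s-nil , n∉h) = not-intro _ (λ q →
    n∉h (subst (inDom h) (just-injective (trans (sym (s-val nilIx)) (trans (cong s nilIx-nil) s-nil)))
        (proj₁ (allocated-correct d nilIx) q)))

  disjoint-correct : ∀ {h h₁} (d : Decomposition h) (d₁ : Decomposition h₁) → Compatible s h h₁ →
                     disjoint (types (chunks d)) (types (chunks d₁)) ≡ true
  disjoint-correct d d₁ (dom-disjoint , _) = all-intro _ (allFin N) (λ k _ → not-intro _ (λ q →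
    dom-disjoint (val k) (proj₁ (allocated-correct d k) (∧-elimˡ (allocated (types (chunks d)) k) q) ,
                          proj₁ (allocated-correct d₁ k) (∧-elimʳ (allocated (types (chunks d)) k) q))))

  -- Distinct typed chunks have distinct named sources, so there are at most N of them.
  named-sources : ∀ (Cs : List (Chunk N)) → AllPairs ChunksApart Cs → AllClassified Cs →
    ∃ λ ks → length ks ≡ length (types Cs) × Unique (map val ks) × (∀ {k} → k ∈ ks → ∃ λ C → C ∈ Cs × val k ∈ sources (proj₁ C))
  named-sources [] _ _ = [] , refl , [] , λ ()
  named-sources ((g , nothing) ∷ Cs) (_ ∷ apart-Cs) cl with named-sources Cs apart-Cs (λ m → cl (there m))
  ... | ks , len , u , in-Cs = ks , len , u , λ m → let (C , m₁ , m₂) = in-Cs m in C , there m₁ , m₂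
  named-sources ((g , just t) ∷ Cs) (apart-g ∷ apart-Cs) cl with named-sources Cs apart-Cs
      (λ m → cl (there m)) | HasType-named-source t (cl (here refl))
  ... | ks , len , u , in-Cs | k₀ , k₀∈g = k₀ ∷ ks , cong suc len , All.tabulate fresh-k₀ ∷ u , in-chunks
    where
    fresh-k₀ : ∀ {l} → l ∈ map val ks → val k₀ ≢ l
    fresh-k₀ m refl with ∈-map⁻ val m
    ... | k , k∈ks , e with in-Cs k∈ks
    ... | C , m₁ , k∈C = Apart⇒sources-disjoint (All.lookup apart-g m₁) k₀∈g (subst (_∈ sources (proj₁ C)) (sym e) k∈C)
    in-chunks : ∀ {k} → k ∈ k₀ ∷ ks → ∃ λ C → C ∈ (g , just t) ∷ Cs × val k ∈ sources (proj₁ C)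
    in-chunks (here refl) = (g , just t) , here refl , k₀∈g
    in-chunks (there m) = let (C , m₁ , m₂) = in-Cs m in C , there m₁ , m₂

  types-length≤ : ∀ {h} (d : Decomposition h) → length (types (chunks d)) ≤ N
  types-length≤ d with named-sources (chunks d) (apart d) (classified d)
  ... | ks , len , u , _ = begin
    length (types (chunks d))  ≡⟨ sym len ⟩
    length ks                  ≡⟨ sym (length-map val ks) ⟩
    length (map val ks)        ≤⟨ Unique-⊆⇒length≤ u
        (λ x m → let (k , _ , e) = ∈-map⁻ val m in subst (_∈ map val (allFin N)) (sym e) (∈-map⁺ val (∈-allFin k))) ⟩
    length (map val (allFin N)) ≡⟨ length-map val (allFin N) ⟩
    length (allFin N)          ≡⟨ length-tabulate id ⟩
    N                          ∎
    where open ≤-Reasoning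

  types∈candidates : ∀ {h} (d : Decomposition h) → types (chunks d) ∈ candidates
  types∈candidates d = ∈-lists≤ ∈-allChunkTypes N (types (chunks d)) (types-length≤ d)

  empty⇒no-chunks : ∀ {h} (d : Decomposition h) → EmptyHeap h → chunks d ≡ []
  empty⇒no-chunks d eh with chunks d in eq
  ... | [] = refl
  ... | C ∷ _ with inhabited d (subst (C ∈_) (sym eq) (here refl))
  ... | (a , b) , me with trans (sym (unH (sound d (subst (C ∈_) (sym eq) (here refl)) me))) (eh a)
  ... | ()

  no-chunks⇒empty : ∀ {h} (d : Decomposition h) → chunks d ≡ [] → EmptyHeap h
  no-chunks⇒empty {h} d eq l with fn h l in q
  ... | nothing = refl
  ... | just v with complete d (inH {l , v} {h} q)
  ... | C , m , _ = ⊥-elim (lem (subst (C ∈_) eq m))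
    where
    lem : C ∉ []
    lem ()

  no-chunks : ∀ {M} (Cs : List (Chunk M)) → types Cs ≡ [] → anonymous Cs ≡ 0 → Cs ≡ []
  no-chunks [] _ _ = refl
  no-chunks ((g , just t) ∷ Cs) () _
  no-chunks ((g , nothing) ∷ Cs) _ ()

  Linked? : ∀ e e′ → Dec (Linked e e′)
  Linked? e e′ = map′ f g (Any.any? (λ l → (l ∈? endpoints e′) ×-dec ¬? (Named? l)) (endpoints e)) ⊎-dec (proj₁ e ≟ proj₁ e′)
    where
    f : Any (λ l → l ∈ endpoints e′ × ¬ Named l) (endpoints e) → ∃ λ l → l ∈ endpoints e × l ∈ endpoints e′ × ¬ Named l
    f a = let (l , m , (m₂ , unnamed)) = find a in l , m , m₂ , unnamed
    g : (∃ λ l → l ∈ endpoints e × l ∈ endpoints e′ × ¬ Named l) → Any (λ l → l ∈ endpoints e′ × ¬ Named l) (endpoints e)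
    g (l , m , m₂ , unnamed) = Any.map (λ { refl → m₂ , unnamed }) m

  record Components (es : List Edge) (gs : List (List Edge)) : Set₁ where
    field
      comp-sound : ∀ {g e} → g ∈ gs → e ∈ g → e ∈ es
      comp-complete : ∀ {e} → e ∈ es → ∃ λ g → g ∈ gs × e ∈ g
      comp-inhabited : ∀ {g} → g ∈ gs → ∃ λ e → e ∈ g
      comp-connected : ∀ {g} → g ∈ gs → Connected g
      comp-apart : AllPairs Apart gs
  open Components

  insertEdge : ∀ e {es gs} → Components es gs → Σ (List (List Edge)) (Components (e ∷ es))
  insertEdge e {es} {gs} cs with partition-with (λ g → Any.any? (Linked? e) g) gs
  ... | linked , unlinked , i , linked-e , unlinked-e = merged ∷ unlinked , record
    { comp-sound = sound′ ; comp-complete = complete′ ; comp-inhabited = inhabited′ ; comp-connected = connected′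
    ; comp-apart = All.tabulate merged-apart ∷ proj₂ (AllPairs-interleaving⁻ i (comp-apart cs)) }
    where
    merged = e ∷ concat linked
    sound′ : ∀ {g e′} → g ∈ merged ∷ unlinked → e′ ∈ g → e′ ∈ e ∷ es
    sound′ (here refl) (here refl) = here refl
    sound′ (here refl) (there m) = let (g₀ , m₁ , m₂) = ∈-concat⁻′ linked m in there (comp-sound cs (∈-interleavingˡ i m₂) m₁)
    sound′ (there m) me = there (comp-sound cs (∈-interleavingʳ i m) me)
    complete′ : ∀ {e′} → e′ ∈ e ∷ es → ∃ λ g → g ∈ merged ∷ unlinked × e′ ∈ g
    complete′ (here refl) = merged , here refl , here refl
    complete′ (there m) with comp-complete cs m
    ... | g , g∈gs , me with ∈-interleaving⁻ i g∈gs
    ... | inj₁ m₁ = merged , here refl , there (∈-concat⁺′ me m₁)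
    ... | inj₂ m₂ = g , there m₂ , me
    inhabited′ : ∀ {g} → g ∈ merged ∷ unlinked → ∃ λ e′ → e′ ∈ g
    inhabited′ (here refl) = e , here refl
    inhabited′ (there m) = comp-inhabited cs (∈-interleavingʳ i m)
    connected′ : ∀ {g} → g ∈ merged ∷ unlinked → Connected g
    connected′ (here refl) = Connected-merge e linked (λ m → comp-connected cs (∈-interleavingˡ i m)) linked-e
    connected′ (there m) = comp-connected cs (∈-interleavingʳ i m)
    merged-apart : ∀ {u} → u ∈ unlinked → Apart merged u
    merged-apart u∈unlinked (here refl) my e-linked = unlinked-e u∈unlinked (Any.map (λ { refl → e-linked }) my)
    merged-apart u∈unlinked (there m) my e-linked with ∈-concat⁻′ linked m
    ... | g₀ , x∈g₀ , g₀∈linked = AllPairs-interleaving-across (λ {x} {y} → Apart-sym {x} {y}) i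
        (comp-apart cs) g₀∈linked u∈unlinked x∈g₀ my e-linked

  components : (es : List Edge) → Σ (List (List Edge)) (Components es)
  components [] = [] , record { comp-sound = λ () ; comp-complete = λ () ; comp-inhabited = λ () ; comp-connected = λ
      () ; comp-apart = [] }
  components (e ∷ es) = insertEdge e (proj₂ (components es))

  edgesOf : Heap → List Loc → List Edge
  edgesOf h [] = []
  edgesOf h (l ∷ locs) with fn h l
  ... | nothing = edgesOf h locs
  ... | just v = (l , v) ∷ edgesOf h locs

  edgesOf-sound : ∀ h locs {e} → e ∈ edgesOf h locs → e ∈H h
  edgesOf-sound h (l ∷ locs) m with fn h l in eq
  edgesOf-sound h (l ∷ locs) (here refl) | just v = inH eq
  edgesOf-sound h (l ∷ locs) (there m) | just v = edgesOf-sound h locs m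
  ... | nothing = edgesOf-sound h locs m

  edgesOf-complete : ∀ h locs {a b} → fn h a ≡ just b → a ∈ locs → (a , b) ∈ edgesOf h locs
  edgesOf-complete h (l ∷ locs) q m with fn h l in eq
  edgesOf-complete h (l ∷ locs) q (here refl) | just v = here (cong (_ ,_) (just-injective (trans (sym q) eq)))
  edgesOf-complete h (l ∷ locs) q (there m) | just v = there (edgesOf-complete h locs q m)
  edgesOf-complete h (l ∷ locs) q (here refl) | nothing = ⊥-elim (just≢nothing (trans (sym q) eq))
  edgesOf-complete h (l ∷ locs) q (there m) | nothing = edgesOf-complete h locs q m

  mutual
    follow : Heap → ℕ → ℕ → Maybe (List ℕ × ℕ)
    follow h zero a = nothing
    follow h (suc f) a = followFrom h f (fn h a)

    followFrom : Heap → ℕ → Maybe ℕ → Maybe (List ℕ × ℕ)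
    followFrom h f nothing = nothing
    followFrom h f (just v) = followTo h f v (Named? v)

    followTo : Heap → ℕ → (v : ℕ) → Dec (Named v) → Maybe (List ℕ × ℕ)
    followTo h f v (yes _) = just ([] , v)
    followTo h f v (no _) = Maybe.map (λ p → (v ∷ proj₁ p , proj₂ p)) (follow h f v)

  follow-segment : ∀ h f a us b → (∀ {e} → e ∈ cells a (us ++ b ∷ []) → e ∈H h) → All (λ u → ¬ Named u) us → Named b
      → length us < f →
    follow h f a ≡ just (us , b)
  follow-segment h (suc f) a [] b sub unnamed lb le = trans (cong (followFrom h f) (unH (sub (here refl)))) (lem (Named? b))
    where
    lem : (d : Dec (Named b)) → followTo h f b d ≡ just ([] , b)
    lem (yes _) = refl
    lem (no nb) = ⊥-elim (nb lb)
  follow-segment h (suc f) a (u ∷ us) b sub (nu ∷ unnamed) lb (s≤s le) = trans (cong (followFrom h f) (unH (sub (here refl))))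
      (lem (Named? u))
    where
    lem : (d : Dec (Named u)) → followTo h f u d ≡ just (u ∷ us , b)
    lem (yes lu) = ⊥-elim (nu lu)
    lem (no _) = cong (Maybe.map (λ p → (u ∷ proj₁ p , proj₂ p))) (follow-segment h f u us b (λ m → sub (there m)) unnamed lb le)

  _⊆ᴱ?_ : (g g′ : List Edge) → Dec (∀ {e} → e ∈ g → e ∈ g′)
  g ⊆ᴱ? g′ = map′ All.lookup All.tabulate (All.all? (λ e → DecMembership._∈?_ _≟ᴱ_ e g′) g)

  IsSegment? : ∀ g a b us → Dec (IsSegment g a b us)
  IsSegment? g a b us =
    (g ⊆ᴱ? path ×-dec path ⊆ᴱ? g) ×-dec
    (All.all? (λ u → ¬? (Named? u)) us ×-dec (allPairs? (λ x y → ¬? (x ≟ y)) (a ∷ us) ×-dec (Named? a ×-dec Named? b)))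
    where path = cells a (us ++ b ∷ [])

  module _ {h : Heap} where
    -- A chunk with a named source a is a segment exactly when following the heap from a
    -- through unnamed locations traces all of it; otherwise it is garbage.
    classify : (g : List Edge) → (∀ {e} → e ∈ g → e ∈H h) → Σ (Maybe (ChunkType N)) (Classified g)
    classify g in-h with Any.any? Named? (sources g)
    ... | no unnamed = nothing , λ l m named-b → unnamed (Any.map (λ { refl → named-b }) m)
    ... | yes some-named with find some-named
    ... | a , a∈g , (i₀ , refl) = by-path (follow h (suc (length g)) a) refl
      where
      members : Vec Bool N
      members = tabulate (λ k → ⌊ val k ∈? sources g ⌋)
      members-sources : ∀ k → lookup members k ≡ true → val k ∈ sources g
      members-sources k q = dec-true⁻ (val k ∈? sources g) (trans (sym (lookup∘tabulate _ k)) q)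
      sources-members : ∀ k → val k ∈ sources g → lookup members k ≡ true
      sources-members k m = trans (lookup∘tabulate _ k) (dec-true⁺ (val k ∈? sources g) m)
      not-segment : (∀ us b → follow h (suc (length g)) (val i₀) ≡ just (us , b) → ¬ IsSegment g (val i₀) b us)
          → ¬ SegmentShaped g
      not-segment untraced (a′ , b′ , us′ , w@(eq , unnamed , u , named-a , named-b)) with IsSegment-named-source w
          (i₀ , refl) a∈g
      ... | refl = untraced us′ b′
          (follow-segment h (suc (length g)) (val i₀) us′ b′ (λ m → in-h (proj₂ eq m)) unnamed named-b (s≤s us-short)) w
        where
        us-short : length us′ ≤ length g
        us-short = ≤-trans (Unique-⊆⇒length≤ (AllPairs.drop⁺ 1 u)
            (λ x m → subst (_∈ _) refl (sources-mono (proj₂ eq) (subst (x ∈_) (sym (sources-cells (val i₀) us′ b′)) (there m)))))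
                        (≤-reflexive (length-map proj₁ g))
      as-garbage : (∀ us b → follow h (suc (length g)) (val i₀) ≡ just (us , b) → ¬ IsSegment g (val i₀) b us) → Σ
          (Maybe (ChunkType N)) (Classified g)
      as-garbage untraced = just (garbage members) , members-sources , (λ k m → k , sources-members k m , refl) ,
          (i₀ , sources-members i₀ a∈g) , not-segment untraced
      by-path : (r : Maybe (List ℕ × ℕ)) → follow h (suc (length g)) (val i₀) ≡ r → Σ (Maybe (ChunkType N)) (Classified g)
      by-path nothing follow≡ = as-garbage (λ us b q _ → just≢nothing (trans (sym q) follow≡))
      by-path (just (us , b)) follow≡ with IsSegment? g (val i₀) b us
      ... | no ¬segment = as-garbage
          (λ us′ b′ q w → ¬segment
          (subst (λ p → IsSegment g (val i₀) (proj₂ p) (proj₁ p)) (just-injective (trans (sym q) follow≡)) w))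
      ... | yes w = as-segment us b w
        where
        as-segment : ∀ us b → IsSegment g (val i₀) b us → Σ (Maybe (ChunkType N)) (Classified g)
        as-segment [] _ w@(_ , _ , _ , _ , (j₀ , refl)) = just (ptr i₀ j₀) , w
        as-segment (u ∷ us′) _ w@(_ , _ , _ , _ , (j₀ , refl)) = just (seg i₀ j₀) , u , us′ , w

    classifyAll : (gs : List (List Edge)) → (∀ {g e} → g ∈ gs → e ∈ g → e ∈H h) →
      Σ (List (Chunk N)) λ Cs → map proj₁ Cs ≡ gs × (∀ {C} → C ∈ Cs → Classified (proj₁ C) (proj₂ C))
    classifyAll [] _ = [] , refl , λ ()
    classifyAll (g ∷ gs) in-h with classify g (in-h (here refl)) | classifyAll gs (λ m → in-h (there m))
    ... | (t , classified-g) | Cs , eq , classified-Cs = (g , t) ∷ Cs , cong (g ∷_) eq ,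
        λ { (here refl) → classified-g ; (there m) → classified-Cs m }

  decompose : (h : Heap) → Decomposition h
  decompose h = record
    { chunks = Cs ; sound = sound′ ; complete = complete′
    ; inhabited = λ m → comp-inhabited cs (C∈gs m) ; connected = λ m → comp-connected cs (C∈gs m)
    ; apart = AllPairs.map⁻ (subst (AllPairs Apart) (sym gs≡) (comp-apart cs)) ; classified = all-classified }
    where
    edges = edgesOf h (proj₁ (fin h))
    comps = components edges
    gs = proj₁ comps
    cs = proj₂ comps
    classified-gs = classifyAll {h} gs (λ m me → edgesOf-sound h (proj₁ (fin h)) (comp-sound cs m me))
    Cs = proj₁ classified-gs
    gs≡ : map proj₁ Cs ≡ gs
    gs≡ = proj₁ (proj₂ classified-gs)
    all-classified = proj₂ (proj₂ classified-gs)
    C∈gs : ∀ {C} → C ∈ Cs → proj₁ C ∈ gs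
    C∈gs m = subst (_ ∈_) gs≡ (∈-map⁺ proj₁ m)
    sound′ : ∀ {C e} → C ∈ Cs → e ∈ proj₁ C → e ∈H h
    sound′ m me = edgesOf-sound h (proj₁ (fin h)) (comp-sound cs (C∈gs m) me)
    complete′ : ∀ {e} → e ∈H h → ∃ λ C → C ∈ Cs × e ∈ proj₁ C
    complete′ {a , b} (inH q) with comp-complete cs (edgesOf-complete h (proj₁ (fin h)) q (proj₂ (fin h) a b q))
    ... | g , g∈gs , me with ∈-map⁻ proj₁ (subst (g ∈_) (sym gs≡) g∈gs)
    ... | C , C∈Cs , refl = C , C∈Cs , me

  -- Realising abstract states

  module Realisation (F : ℕ) (val<F : ∀ i → val i < F) where

    fresh : ℕ → ℕ
    fresh q = F + q

    fresh-unnamed : ∀ q → ¬ Named (fresh q)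
    fresh-unnamed q (i , e) = <⇒≱ (val<F i) (≤-trans (m≤m+n F q) (≤-reflexive (sym e)))

    val≢fresh : ∀ i q → val i ≢ fresh q
    val≢fresh i q e = fresh-unnamed q (i , e)

    fresh-injective : ∀ {q q′} → fresh q ≡ fresh q′ → q ≡ q′
    fresh-injective {q} {q′} e = +-cancelˡ-≡ F q q′ e

    members : Vec Bool N → List (Fin N)
    members S = filter (λ k → lookup S k Bool.≟ true) (allFin N)

    -- The q-th chunk gets the location F + q, above all named ones, as its only unnamed location.
    chunkEdges : ℕ → ChunkType N → List Edge
    chunkEdges q (ptr i j) = (val i , val j) ∷ []
    chunkEdges q (seg i j) = (val i , fresh q) ∷ (fresh q , val j) ∷ []
    chunkEdges q (garbage S) = map (λ k → (val k , fresh q)) (members S)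

    anonEdges : ℕ → List Edge
    anonEdges q = (fresh q , fresh q) ∷ []

    realise : ℕ → List (ChunkType N) → ℕ → List (Chunk N)
    realise q [] zero = []
    realise q [] (suc m) = (anonEdges q , nothing) ∷ realise (suc q) [] m
    realise q (t ∷ T) m = (chunkEdges q t , just t) ∷ realise (suc q) T m

    types-realise : ∀ q T m → types (realise q T m) ≡ T
    types-realise q [] zero = refl
    types-realise q [] (suc m) = types-realise (suc q) [] m
    types-realise q (t ∷ T) m = cong (t ∷_) (types-realise (suc q) T m)

    anonymous-realise : ∀ q T m → anonymous (realise q T m) ≡ m
    anonymous-realise q [] zero = refl
    anonymous-realise q [] (suc m) = cong suc (anonymous-realise (suc q) [] m)
    anonymous-realise q (t ∷ T) m = anonymous-realise (suc q) T m

    ∈-garbageEdges : ∀ q S {e} → e ∈ chunkEdges q (garbage S) → ∃ λ k → lookup S k ≡ true × e ≡ (val k , fresh q)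
    ∈-garbageEdges q S m with ∈-map⁻ (λ k → (val k , fresh q)) m
    ... | k , mk , refl = k , proj₂ (∈-filter⁻ (λ k → lookup S k Bool.≟ true) {xs = allFin N} mk) , refl

    chunkEdges-locs : ∀ q t {e l} → e ∈ chunkEdges q t → l ∈ endpoints e → Named l ⊎ l ≡ fresh q
    chunkEdges-locs q (ptr i j) (here refl) (here refl) = inj₁ (i , refl)
    chunkEdges-locs q (ptr i j) (here refl) (there (here refl)) = inj₁ (j , refl)
    chunkEdges-locs q (seg i j) (here refl) (here refl) = inj₁ (i , refl)
    chunkEdges-locs q (seg i j) (here refl) (there (here refl)) = inj₂ refl
    chunkEdges-locs q (seg i j) (there (here refl)) (here refl) = inj₂ refl
    chunkEdges-locs q (seg i j) (there (here refl)) (there (here refl)) = inj₁ (j , refl)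
    chunkEdges-locs q (garbage S) m lm with ∈-garbageEdges q S m
    chunkEdges-locs q (garbage S) m (here refl) | k , _ , refl = inj₁ (k , refl)
    chunkEdges-locs q (garbage S) m (there (here refl)) | k , _ , refl = inj₂ refl

    chunkEdges-allocates : ∀ q t {a b} → (a , b) ∈ chunkEdges q t → ∀ k → val k ≡ a → allocates t k ≡ true
    chunkEdges-allocates q (ptr i j) (here refl) k e = ≡⇒≈ᵇ (sym e)
    chunkEdges-allocates q (seg i j) (here refl) k e = ≡⇒≈ᵇ (sym e)
    chunkEdges-allocates q (seg i j) (there (here refl)) k e = ⊥-elim (val≢fresh k q e)
    chunkEdges-allocates q (garbage S) m k e with ∈-garbageEdges q S m
    ... | k₀ , k∈S , refl = any-intro (λ m → lookup S m ∧ (m ≈ᵇ k)) (∈-allFin k₀) (∧-intro k∈S (≡⇒≈ᵇ (sym e)))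

    chunkEdges-functional : ∀ q t {a b b′} → (a , b) ∈ chunkEdges q t → (a , b′) ∈ chunkEdges q t → b ≡ b′
    chunkEdges-functional q (ptr i j) (here refl) (here refl) = refl
    chunkEdges-functional q (seg i j) (here refl) (here refl) = refl
    chunkEdges-functional q (seg i j) (here refl) (there (here e)) = ⊥-elim (val≢fresh i q (cong proj₁ e))
    chunkEdges-functional q (seg i j) (there (here refl)) (here e) = ⊥-elim (val≢fresh i q (sym (cong proj₁ e)))
    chunkEdges-functional q (seg i j) (there (here refl)) (there (here refl)) = refl
    chunkEdges-functional q (garbage S) m m′ with ∈-garbageEdges q S m | ∈-garbageEdges q S m′
    ... | _ , _ , e1 | _ , _ , e2 = trans (cong proj₂ e1) (sym (cong proj₂ e2))

    chunkEdges-connected : ∀ q t → Connected (chunkEdges q t)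
    chunkEdges-connected q (ptr i j) = Connected-singleton _
    chunkEdges-connected q (seg i j) P cl (here refl) (here refl) p = p
    chunkEdges-connected q (seg i j) P cl (there (here refl)) (there (here refl)) p = p
    chunkEdges-connected q (seg i j) P cl (here refl) (there (here refl)) p = cl (here refl) (there (here refl))
        (inj₁ (fresh q , there (here refl) , here refl , fresh-unnamed q)) p
    chunkEdges-connected q (seg i j) P cl (there (here refl)) (here refl) p = cl (there (here refl)) (here refl)
        (inj₁ (fresh q , here refl , there (here refl) , fresh-unnamed q)) p
    chunkEdges-connected q (garbage S) P cl {e} {e′} m m′ p with ∈-garbageEdges q S m | ∈-garbageEdges q S m′
    ... | _ , _ , e1 | _ , _ , e2 = cl m m′
        (inj₁ (fresh q , subst (λ z → fresh q ∈ endpoints z) (sym e1) (there (here refl)) , subst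
        (λ z → fresh q ∈ endpoints z) (sym e2) (there (here refl)) , fresh-unnamed q)) p

    chunkEdges-type : ∀ q t → nonempty t ≡ true → HasType (chunkEdges q t) t
    chunkEdges-type q (ptr i j) _ = (id , id) , [] , (All.[] ∷ []) , (i , refl) , (j , refl)
    chunkEdges-type q (seg i j) _ =
      fresh q , [] , (id , id) , (fresh-unnamed q ∷ []) , ((val≢fresh i q ∷ []) ∷ ([] ∷ [])) , (i , refl) , (j , refl)
    chunkEdges-type q (garbage S) ne = members-sources , sources-members , some-member , not-segment
      where
      members-sources : ∀ k → lookup S k ≡ true → val k ∈ sources (chunkEdges q (garbage S))
      members-sources k k∈S =
        ∈-sources⁺ _ (∈-map⁺ (λ k → (val k , fresh q)) (∈-filter⁺ (λ k → lookup S k Bool.≟ true) (∈-allFin k) k∈S))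
      sources-members : ∀ k → val k ∈ sources (chunkEdges q (garbage S)) → ∃ λ m → lookup S m ≡ true × val m ≡ val k
      sources-members k mk with ∈-sources⁻ _ mk
      ... | _ , me with ∈-garbageEdges q S me
      ... | k₀ , k∈S , e = k₀ , k∈S , sym (cong proj₁ e)
      some-member : ∃ λ k → lookup S k ≡ true
      some-member = let (k , _ , k∈S) = any-elim (lookup S) (allFin N) ne in k , k∈S
      not-segment : ¬ SegmentShaped (chunkEdges q (garbage S))
      not-segment (a , b , [] , (eq , _ , _ , _ , (jb , eb))) with ∈-garbageEdges q S (proj₂ eq (here refl))
      ... | k , _ , e = val≢fresh jb q (trans eb (cong proj₂ e))
      not-segment (a , b , (u ∷ us) , (eq , (nu ∷ _) , _ , _ , _)) with ∈-garbageEdges q S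
          (proj₂ eq (there (proj₂ (cells-first u us b))))
      ... | k , _ , e = nu (k , sym (cong proj₁ e))

    chunkEdges-inhabited : ∀ q t → nonempty t ≡ true → ∃ λ e → e ∈ chunkEdges q t
    chunkEdges-inhabited q (ptr i j) _ = _ , here refl
    chunkEdges-inhabited q (seg i j) _ = _ , here refl
    chunkEdges-inhabited q (garbage S) ne with chunkEdges-type q (garbage S) ne
    ... | members-sources , _ , (k , k∈S) , _ = let (_ , me) = ∈-sources⁻ _ (members-sources k k∈S) in _ , me

    consistent-tail : ∀ {t T} → consistent (t ∷ T) ≡ true → consistent T ≡ true
    consistent-tail {t} {T} v = ∧-elimʳ (disjoint (t ∷ []) T) (∧-elimʳ (nonempty t) v)

    consistent⇒nonempty : ∀ {t T} → consistent T ≡ true → t ∈ T → nonempty t ≡ true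
    consistent⇒nonempty {T = t ∷ T} v (here refl) = ∧-elimˡ (nonempty t) v
    consistent⇒nonempty {T = t ∷ T} v (there m) = consistent⇒nonempty (consistent-tail {t} {T} v) m

    data Realised (q : ℕ) (T : List (ChunkType N)) : Chunk N → Set where
      anon : ∀ {q′} → q ≤ q′ → Realised q T (anonEdges q′ , nothing)
      typed : ∀ {q′ t} → q ≤ q′ → t ∈ T → Realised q T (chunkEdges q′ t , just t)

    freshIndex : ∀ {q T C} → Realised q T C → ℕ
    freshIndex (anon {q′} _) = q′
    freshIndex (typed {q′} _ _) = q′

    freshIndex-≥ : ∀ {q T C} (r : Realised q T C) → q ≤ freshIndex r
    freshIndex-≥ (anon le) = le
    freshIndex-≥ (typed le _) = le

    Realised-weaken : ∀ {q T T′ C} → (∀ {t} → t ∈ T → t ∈ T′) → Realised (suc q) T C → Realised q T′ C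
    Realised-weaken sub (anon le) = anon (≤-trans (n≤1+n _) le)
    Realised-weaken sub (typed le m) = typed (≤-trans (n≤1+n _) le) (sub m)

    ∈-realise : ∀ q T m {C} → C ∈ realise q T m → Realised q T C
    ∈-realise q [] (suc m) (here refl) = anon ≤-refl
    ∈-realise q [] (suc m) (there m′) = Realised-weaken id (∈-realise (suc q) [] m m′)
    ∈-realise q (t ∷ T) m (here refl) = typed ≤-refl (here refl)
    ∈-realise q (t ∷ T) m (there m′) = Realised-weaken there (∈-realise (suc q) T m m′)

    Realised-locs : ∀ {q T C e l} (r : Realised q T C) → e ∈ proj₁ C → l ∈ endpoints e → Named l ⊎ l ≡ fresh (freshIndex r)
    Realised-locs (anon _) (here refl) (here refl) = inj₂ refl
    Realised-locs (anon _) (here refl) (there (here refl)) = inj₂ refl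
    Realised-locs (typed {q′} {t} _ _) me ml = chunkEdges-locs q′ t me ml

    Realised-allocates : ∀ {q T C a b k} → Realised q T C → (a , b) ∈ proj₁ C → val k ≡ a →
                         ∃ λ t → t ∈ T × allocates t k ≡ true
    Realised-allocates (anon {q′} _) (here refl) e = ⊥-elim (val≢fresh _ q′ e)
    Realised-allocates (typed {q′} {t} _ m) me e = t , m , chunkEdges-allocates q′ t me _ e

    linked⇒co-allocated : ∀ {q q′ T T′ C C′ e e′} (r : Realised q T C) (r′ : Realised q′ T′ C′) → freshIndex r ≢ freshIndex r′ →
      e ∈ proj₁ C → e′ ∈ proj₁ C′ → Linked e e′ →
      ∃ λ k → (∃ λ t → t ∈ T × allocates t k ≡ true) × (∃ λ t → t ∈ T′ × allocates t k ≡ true)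
    linked⇒co-allocated r r′ distinct me me′ (inj₁ (l , ml , ml′ , unnamed)) with Realised-locs r me ml | Realised-locs r′ me′ ml′
    ... | inj₁ named | _ = ⊥-elim (unnamed named)
    ... | inj₂ _ | inj₁ named = ⊥-elim (unnamed named)
    ... | inj₂ e₁ | inj₂ e₂ = ⊥-elim (distinct (fresh-injective (trans (sym e₁) e₂)))
    linked⇒co-allocated {e = a , b} {e′ = a′ , b′} r r′ distinct me me′ (inj₂ refl)
      with Realised-locs r me (here refl) | Realised-locs r′ me′ (here refl)
    ... | inj₁ (k , vk) | _ = k , Realised-allocates r me vk , Realised-allocates r′ me′ vk
    ... | inj₂ e₁ | inj₁ named = ⊥-elim (fresh-unnamed _ (subst Named e₁ named))
    ... | inj₂ e₁ | inj₂ e₂ = ⊥-elim (distinct (fresh-injective (trans (sym e₁) e₂)))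

    head-apart : ∀ {q T₀ T C₀ C} (r₀ : Realised q T₀ C₀) (r : Realised (suc q) T C) → freshIndex r₀ ≡ q →
      (∀ {k} → (∃ λ t → t ∈ T₀ × allocates t k ≡ true) → (∃ λ t → t ∈ T × allocates t k ≡ true) → ⊥) →
      ChunksApart C₀ C
    head-apart r₀ r eq clash me me′ lk =
      let (_ , a₀ , a) = linked⇒co-allocated r₀ r (λ e → 1+n≰n (subst (suc _ ≤_) (trans (sym e) eq) (freshIndex-≥ r))) me me′ lk
      in clash a₀ a

    realise-apart : ∀ q T m → consistent T ≡ true → AllPairs ChunksApart (realise q T m)
    realise-apart q [] zero v = []
    realise-apart q [] (suc m) v =
      All.tabulate (λ m′ → head-apart {T₀ = []} (anon ≤-refl) (∈-realise (suc q) [] m m′) refl λ { (_ , () , _) _ }) ∷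
      realise-apart (suc q) [] m v
    realise-apart q (t ∷ T) m v =
      All.tabulate (λ m′ → head-apart {T₀ = t ∷ []} (typed ≤-refl (here refl)) (∈-realise (suc q) T m m′) refl clash) ∷
      realise-apart (suc q) T m (consistent-tail {t} {T} v)
      where
      clash : ∀ {k} → (∃ λ t′ → t′ ∈ t ∷ [] × allocates t′ k ≡ true) → (∃ λ t′ → t′ ∈ T × allocates t′ k ≡ true) → ⊥
      clash {k} (_ , here refl , a₀) (_ , m′ , a) =
        not-elim _ (all-elim _ (allFin N) (∧-elimˡ (disjoint (t ∷ []) T) (∧-elimʳ (nonempty t) v)) (∈-allFin k))
                   (∧-intro (∨-introˡ false a₀) (any-intro (λ t → allocates t k) m′ a))

    Realised-functional : ∀ {q T C} → Realised q T C → Functional (proj₁ C)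
    Realised-functional (anon _) (here refl) (here refl) = refl
    Realised-functional (typed {q′} {t} _ _) = chunkEdges-functional q′ t

    allEdges : List (Chunk N) → List Edge
    allEdges Cs = concat (map proj₁ Cs)

    module _ (T : List (ChunkType N)) (m : ℕ) (v : consistent T ≡ true) where

      realised : List (Chunk N)
      realised = realise 0 T m

      ∈-allEdges⁻ : ∀ {e} → e ∈ allEdges realised → ∃ λ C → C ∈ realised × e ∈ proj₁ C
      ∈-allEdges⁻ me with ∈-concat⁻′ (map proj₁ realised) me
      ... | g , me′ , mg with ∈-map⁻ proj₁ mg
      ... | C , mC , refl = C , mC , me′

      ∈-allEdges⁺ : ∀ {C e} → C ∈ realised → e ∈ proj₁ C → e ∈ allEdges realised
      ∈-allEdges⁺ mC me = ∈-concat⁺′ me (∈-map⁺ proj₁ mC)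

      allEdges-functional : Functional (allEdges realised)
      allEdges-functional m₁ m₂ with ∈-allEdges⁻ m₁ | ∈-allEdges⁻ m₂
      ... | C₁ , mC₁ , me₁ | C₂ , mC₂ , me₂ with ∈-AllPairs₂ (realise-apart 0 T m v) mC₁ mC₂
      ... | inj₁ refl = Realised-functional (∈-realise 0 T m mC₁) me₁ me₂
      ... | inj₂ (inj₁ sp) = ⊥-elim (sp me₁ me₂ (inj₂ refl))
      ... | inj₂ (inj₂ sp) = ⊥-elim (sp me₂ me₁ (inj₂ refl))

      realisedHeap : Heap
      realisedHeap = heapOf (allEdges realised)

      realisedDecomposition : Decomposition realisedHeap
      realisedDecomposition = record
        { chunks = realised
        ; sound = λ mC me → inH (lookupL-complete (allEdges realised) allEdges-functional (∈-allEdges⁺ mC me))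
        ; complete = λ { {a , b} (inH q) → ∈-allEdges⁻ (lookupL-sound (allEdges realised) q) }
        ; inhabited = λ mC → inhabited′ (∈-realise 0 T m mC)
        ; connected = λ mC → connected′ (∈-realise 0 T m mC)
        ; apart = realise-apart 0 T m v
        ; classified = λ mC → classified′ (∈-realise 0 T m mC) }
        where
        inhabited′ : ∀ {C} → Realised 0 T C → ∃ λ e → e ∈ proj₁ C
        inhabited′ (anon _) = _ , here refl
        inhabited′ (typed {q′} {t} _ mt) = chunkEdges-inhabited q′ t (consistent⇒nonempty v mt)
        connected′ : ∀ {C} → Realised 0 T C → Connected (proj₁ C)
        connected′ (anon _) = Connected-singleton _
        connected′ (typed {q′} {t} _ _) = chunkEdges-connected q′ t
        classified′ : ∀ {C} → Realised 0 T C → Classified (proj₁ C) (proj₂ C)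
        classified′ (anon {q′} _) l (here refl) = fresh-unnamed q′
        classified′ (typed {q′} {t} _ mt) = chunkEdges-type q′ t (consistent⇒nonempty v mt)

      realised-types : types (chunks realisedDecomposition) ≡ T
      realised-types = types-realise 0 T m

      realised-anonymous : anonymous (chunks realisedDecomposition) ≡ m
      realised-anonymous = anonymous-realise 0 T m

      realised-allocated : ∀ k → inDom realisedHeap (val k) → allocated T k ≡ true
      realised-allocated k dm =
        subst (λ T′ → allocated T′ k ≡ true) realised-types (proj₂ (allocated-correct realisedDecomposition k) dm)

      realised-model : L.lookup xs nilIx ≡ nil → nilFree T ≡ true → IsModel s realisedHeap
      realised-model nilIx-nil nil-free =
        val nilIx , trans (cong s (sym nilIx-nil)) (s-val nilIx) , λ dm → not-elim _ nil-free (realised-allocated nilIx dm)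

      realisedHeap-locs : ∀ {l} → inLocs realisedHeap l → Named l ⊎ F ≤ l
      realisedHeap-locs il with inLocs⇒endpoint {realisedHeap} il
      ... | e , q , ml with complete realisedDecomposition q
      ... | C , mC , me with Realised-locs (∈-realise 0 T m mC) me ml
      ... | inj₁ named = inj₁ named
      ... | inj₂ e = inj₂ (≤-trans (m≤m+n F _) (≤-reflexive (sym e)))

  -- List segments as chains of chunks

  -- The clause for ls x y of the semantics, at the values a and b of x and y.
  ListSeg : Heap → Loc → Loc → Set
  ListSeg h a b = (EmptyHeap h × a ≡ b) ⊎
      (∃₂ λ c cs → Unique (sources (cells a (c ∷ cs))) × lastL a (c ∷ cs) ≡ b × ∀ l → fn h l ≡ lookupL (cells a (c ∷ cs)) l)

  IsSegment-named-target : ∀ {g a b us x y} → IsSegment g a b us → Named x → (y , x) ∈ g → x ≡ b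
  IsSegment-named-target {g} {a} {b} {us} (eq , unnamed , _) named-x m with ∈-++⁻ us (∈-cells-target a (us ++ b ∷ []) (proj₁ eq m))
  ... | inj₁ m₁ = ⊥-elim (All.lookup unnamed m₁ named-x)
  ... | inj₂ (here e) = e

  record Removal {h : Heap} (d : Decomposition h) (C : Chunk N) : Set₁ where
    field
      pre post : List (Chunk N)
      eqD : chunks d ≡ pre ++ C ∷ post
      h′ : Heap
      d′ : Decomposition h′
      chunks-d′ : chunks d′ ≡ pre ++ post
      removed : ∀ {l} → l ∈ sources (proj₁ C) → fn h′ l ≡ nothing
      kept : ∀ {l} → l ∉ sources (proj₁ C) → fn h′ l ≡ fn h l

  remove : ∀ {h} (d : Decomposition h) pre C post → chunks d ≡ pre ++ C ∷ post → Removal d C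
  remove {h} d pre C post eqD = record
    { pre = pre ; post = post ; eqD = eqD ; h′ = restrict h L ; d′ = restrictDecomposition d others (C ∷ []) (swap i)
    ; chunks-d′ = refl ; removed = removed′ ; kept = kept′ }
    where
    others = pre ++ post
    L = chunkSources others
    i : Interleaving (C ∷ []) others (chunks d)
    i = subst (Interleaving (C ∷ []) others) (sym eqD) (interleaving-middle pre C post)
    removed′ : ∀ {l} → l ∈ sources (proj₁ C) → restrictFn h L l ≡ nothing
    removed′ {l} l∈C = restrict-∉ h L λ l∈L →
      let (_ , C′∈others , _ , me′) = ∈-chunkSources⁻ others l∈L ; (_ , me) = ∈-sources⁻ (proj₁ C) l∈C
      in apart-across d i (here refl) C′∈others me me′ (inj₂ refl)
    kept′ : ∀ {l} → l ∉ sources (proj₁ C) → restrictFn h L l ≡ fn h l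
    kept′ {l} l∉C = by-membership (l ∈? L)
      where
      by-membership : Dec (l ∈ L) → restrictFn h L l ≡ fn h l
      by-membership (yes l∈L) = restrict-∈ h L l∈L
      by-membership (no l∉L) with fn h l in eq
      ... | nothing = restrict-∉ h L l∉L
      ... | just v with complete d (inH {l , v} {h} eq)
      ... | _ , m , me with ∈-interleaving⁻ i m
      ... | inj₁ (here refl) = ⊥-elim (l∉C (∈-sources⁺ _ me))
      ... | inj₂ m′ = ⊥-elim (l∉L (∈-chunkSources⁺ others m′ me))

  types-split : ∀ (Cs : List (Chunk N)) pre t post → types Cs ≡ pre ++ t ∷ post →
    ∃ λ Dpre → ∃ λ g → ∃ λ Dpost → Cs ≡ Dpre ++ (g , just t) ∷ Dpost × types Dpre ≡ pre × types Dpost ≡ post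
  types-split [] pre t post e = ⊥-elim (lem pre e)
    where
    lem : ∀ pre → [] ≡ pre ++ t ∷ post → ⊥
    lem [] ()
    lem (_ ∷ _) ()
  types-split ((g , nothing) ∷ Cs) pre t post e with types-split Cs pre t post e
  ... | Dpre , g′ , Dpost , e1 , e2 , e3 = (g , nothing) ∷ Dpre , g′ , Dpost , cong (_ ∷_) e1 , e2 , e3
  types-split ((g , just t′) ∷ Cs) [] t post refl = [] , g , Cs , refl , refl , refl
  types-split ((g , just t′) ∷ Cs) (p ∷ pre) t post e with types-split Cs pre t post (∷-injectiveʳ e)
  ... | Dpre , g′ , Dpost , e1 , e2 , e3 = (g , just t′) ∷ Dpre , g′ , Dpost , cong (_ ∷_) e1 , cong₂ _∷_ (∷-injectiveˡ e) e2 , e3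

  types-middle : ∀ (pre : List (Chunk N)) g t post → types (pre ++ (g , just t) ∷ post) ≡ types pre ++ t ∷ types post
  types-middle pre g t post = types-++ pre ((g , just t) ∷ post)

  anonymous-middle : ∀ (pre : List (Chunk N)) g t post → anonymous (pre ++ (g , just t) ∷ post) ≡ anonymous (pre ++ post)
  anonymous-middle pre g t post = trans (anonymous-++ pre ((g , just t) ∷ post)) (sym (anonymous-++ pre post))

  chain-intro : ∀ f T {t R i j} → (t , R) ∈ picks T → chainStep f t R i j ≡ true → chain (suc f) T i j ≡ true
  chain-intro f [] () q
  chain-intro f (x ∷ T) m q = any-intro (λ p → chainStep f (proj₁ p) (proj₂ p) _ _) m q

  chain-elim : ∀ f T {i j} → chain (suc f) T i j ≡ true → T ≡ [] ⊎ ∃ λ p → p ∈ picks T × chainStep f (proj₁ p)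
      (proj₂ p) i j ≡ true
  chain-elim f [] q = inj₁ refl
  chain-elim f (x ∷ T) q = inj₂ (any-elim _ (picks (x ∷ T)) q)

  IsSegType : ChunkType N → Fin N → Fin N → Set
  IsSegType t a c = t ≡ ptr a c ⊎ t ≡ seg a c

  chainStep-seg : ∀ {f t a c R i j} → IsSegType t a c → chainStep f t R i j ≡ (a ≈ᵇ i) ∧ (not (allocated R i) ∧ chain f R c j)
  chainStep-seg (inj₁ refl) = refl
  chainStep-seg (inj₂ refl) = refl

  cells-++-split : ∀ a us d rest → cells a (us ++ d ∷ rest) ≡ cells a (us ++ d ∷ []) ++ cells d rest
  cells-++-split a [] d rest = refl
  cells-++-split a (u ∷ us) d rest = cong ((a , u) ∷_) (cells-++-split u us d rest)

  first-named : ∀ a vs → vs ≢ [] → Named (lastL a vs) → ∃ λ us → ∃ λ dd → ∃ λ rest → vs ≡ us ++ dd ∷ rest × All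
      (λ u → ¬ Named u) us × Named dd
  first-named a [] vs≢[] lb = ⊥-elim (vs≢[] refl)
  first-named a (v ∷ vs) _ lb with Named? v
  ... | yes lv = [] , v , vs , refl , [] , lv
  ... | no nlv with vs
  ... | [] = ⊥-elim (nlv lb)
  ... | w ∷ ws with first-named v (w ∷ ws) (λ ()) lb
  ... | us , dd , rest , e , unnamed , ld = v ∷ us , dd , rest , cong (v ∷_) e , nlv ∷ unnamed , ld

  ∈-cells-endpoint : ∀ a vs {e l} → e ∈ cells a vs → l ∈ endpoints e → l ≡ a ⊎ l ∈ vs
  ∈-cells-endpoint a vs {y , x} m (here refl) = ∈-cells-source a vs m
  ∈-cells-endpoint a vs {y , x} m (there (here refl)) = inj₂ (∈-cells-target a vs m)

  mkListSeg : ∀ {h a b} vs → Unique (sources (cells a vs)) → lastL a vs ≡ b → (∀ l → fn h l ≡ lookupL (cells a vs) l)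
      → ListSeg h a b
  mkListSeg [] _ a≡b h≡[] = inj₁ (h≡[] , a≡b)
  mkListSeg (c ∷ cs) u last h≡cells = inj₂ (c , cs , u , last , h≡cells)

  segment-chunk-cells : ∀ {h} (d : Decomposition h) {C} → C ∈ chunks d → ∀ {a c us} → IsSegment (proj₁ C) a c us →
                        ∀ l → l ∈ sources (proj₁ C) → fn h l ≡ lookupL (cells a (us ++ c ∷ [])) l
  segment-chunk-cells {h} d {C} C∈d {a} {c} {us} (C≅G , _ , unique , _) l l∈C = Maybe-ext ⇒G G⇒
    where
    G = cells a (us ++ c ∷ [])
    ⇒G : ∀ v → fn h l ≡ just v → lookupL G l ≡ just v
    ⇒G v q with ∈-sources⁻ (proj₁ C) l∈C
    ... | _ , me with trans (sym q) (unH (sound d C∈d me))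
    ... | refl = lookupL-complete G (Unique-sources⇒Functional G (subst Unique (sym (sources-cells a us c)) unique))
        (proj₁ C≅G me)
    G⇒ : ∀ v → lookupL G l ≡ just v → fn h l ≡ just v
    G⇒ v q = unH (sound d C∈d (proj₂ C≅G (lookupL-sound G q)))

  segment-then-list : ∀ {h} (d : Decomposition h) {g t} (r : Removal d (g , just t)) → (g , just t) ∈ chunks d → ∀ {a c b us} →
    IsSegment g a c us → ListSeg (Removal.h′ r) c b → ListSeg h a b
  segment-then-list {h} d {g} {t} r g∈d {a} {c} {b} {us} w@(g≅G , unnamed-us , unique , named-a , named-c) rest = extend rest
    where
    open Removal r
    G = cells a (us ++ c ∷ [])
    sources-G : sources G ≡ a ∷ us
    sources-G = sources-cells a us c
    unique-G : Unique (sources G)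
    unique-G = subst Unique (sym sources-G) unique
    g⊆G : ∀ {l} → l ∈ sources g → l ∈ sources G
    g⊆G = sources-mono (proj₁ g≅G)
    G⊆g : ∀ {l} → l ∈ sources G → l ∈ sources g
    G⊆g = sources-mono (proj₂ g≅G)
    h≡G-on-g : ∀ l → l ∈ sources g → fn h l ≡ lookupL G l
    h≡G-on-g = segment-chunk-cells d g∈d w
    extend : ListSeg h′ c b → ListSeg h a b
    extend (inj₁ (h′-empty , refl)) = mkListSeg {h} (us ++ c ∷ []) unique-G (lastL-snoc a us c) h≡G
      where
      h≡G : ∀ l → fn h l ≡ lookupL G l
      h≡G l with l ∈? sources g
      ... | yes l∈g = h≡G-on-g l l∈g
      ... | no l∉g = trans (sym (kept l∉g)) (trans (h′-empty l) (sym (lookupL-∉ G (λ m → l∉g (G⊆g m)))))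
    extend (inj₂ (c′ , cs′ , unique-Q , last-Q , h′≡Q)) = mkListSeg {h} (us ++ c ∷ c′ ∷ cs′) unique-path last-path h≡path
      where
      Q = cells c (c′ ∷ cs′)
      path≡G++Q : cells a (us ++ c ∷ c′ ∷ cs′) ≡ G ++ Q
      path≡G++Q = cells-++-split a us c (c′ ∷ cs′)
      G-Q-disjoint : ∀ {x} → x ∈ a ∷ us → x ∈ sources Q → ⊥
      G-Q-disjoint {x} m₁ m₂ with lookupL-defined Q (proj₂ (∈-sources⁻ Q m₂))
      ... | v , q = just≢nothing (trans (sym (trans (h′≡Q x) q)) (removed (G⊆g (subst (x ∈_) (sym sources-G) m₁))))
      unique-path : Unique (sources (cells a (us ++ c ∷ c′ ∷ cs′)))
      unique-path = subst Unique (sym (trans (cong sources path≡G++Q) (trans (sources-++ G Q) (cong (_++ sources Q) sources-G))))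
                   (Unique.++⁺ unique unique-Q (λ { (m₁ , m₂) → G-Q-disjoint m₁ m₂ }))
      last-path : lastL a (us ++ c ∷ c′ ∷ cs′) ≡ b
      last-path = trans (lastL-++ a us (c ∷ c′ ∷ cs′)) last-Q
      h≡path : ∀ l → fn h l ≡ lookupL (cells a (us ++ c ∷ c′ ∷ cs′)) l
      h≡path l rewrite path≡G++Q | lookupL-++ G Q l with l ∈? sources g
      ... | yes l∈g with lookupL-defined G (proj₂ (∈-sources⁻ G (g⊆G l∈g)))
      ... | v , q rewrite q = trans (h≡G-on-g l l∈g) q
      h≡path l | no l∉g rewrite lookupL-∉ G (λ m → l∉g (G⊆g m)) = trans (sym (kept l∉g)) (h′≡Q l)

  chain⇒ListSeg : ∀ f {h} (d : Decomposition h) i j → length (types (chunks d)) ≡ f → anonymous (chunks d) ≡ 0 →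
                  chain f (types (chunks d)) i j ≡ true → ListSeg h (val i) (val j)
  chain⇒ListSeg zero d i j len no-anonymous q =
    inj₁ (no-chunks⇒empty d (no-chunks (chunks d) no-types no-anonymous) , ≈ᵇ⇒≡ (subst (λ T → chain 0 T i j ≡ true) no-types q))
    where
    no-types = length≡0⇒[] (types (chunks d)) len
  chain⇒ListSeg (suc f) {h} d i j len no-anonymous q with chain-elim f (types (chunks d)) q
  ... | inj₁ no-types = ⊥-elim (0≢1+n (trans (sym (cong length no-types)) len))
  ... | inj₂ ((t , R) , picked , step) with ∈-picks⁻ (types (chunks d)) picked
  ... | pre , post , types≡ , R≡ with types-split (chunks d) pre t post types≡
  ... | before , g , after , chunks≡ , types-before , types-after = from-step t (classified d g∈d) step
    where
    g∈d : (g , just t) ∈ chunks d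
    g∈d = subst ((g , just t) ∈_) (sym chunks≡) (∈-insert before)
    r = remove d before (g , just t) after chunks≡
    open Removal r
    types-d′ : types (chunks d′) ≡ R
    types-d′ = trans (cong types chunks-d′) (trans (types-++ before after) (trans (cong₂ _++_ types-before types-after) (sym R≡)))
    anonymous-d′ : anonymous (chunks d′) ≡ 0
    anonymous-d′ = trans (cong anonymous chunks-d′)
        (trans (sym (anonymous-middle before g t after)) (trans (cong anonymous (sym chunks≡)) no-anonymous))
    length-d′ : length (types (chunks d′)) ≡ f
    length-d′ = trans (cong length (trans (cong types chunks-d′) (types-++ before after)))
      (suc-injective (trans (sym (length-++-sucʳ (types before) t (types after)))
        (trans (cong length (sym (types-middle before g t after))) (trans (cong (λ z → length (types z)) (sym chunks≡)) len))))
    rest : ∀ c → chain f R c j ≡ true → ListSeg h′ (val c) (val j)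
    rest c q′ = chain⇒ListSeg f d′ c j length-d′ anonymous-d′ (subst (λ T → chain f T c j ≡ true) (sym types-d′) q′)
    from-step : ∀ t′ → HasType g t′ → chainStep f t′ R i j ≡ true → ListSeg h (val i) (val j)
    from-step (ptr a c) w step′ = subst (λ z → ListSeg h z (val j)) (≈ᵇ⇒≡ (∧-elimˡ (a ≈ᵇ i) step′))
      (segment-then-list d r g∈d w (rest c (∧-elimʳ (not (allocated R i)) (∧-elimʳ (a ≈ᵇ i) step′))))
    from-step (seg a c) (_ , _ , w) step′ = subst (λ z → ListSeg h z (val j)) (≈ᵇ⇒≡ (∧-elimˡ (a ≈ᵇ i) step′))
      (segment-then-list d r g∈d w (rest c (∧-elimʳ (not (allocated R i)) (∧-elimʳ (a ≈ᵇ i) step′))))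

  record FirstSegment {h : Heap} (d : Decomposition h) (i j : Fin N) : Set₁ where
    field
      before after : List (Chunk N)
      g : List Edge
      t : ChunkType N
      a c : Fin N
      chunks≡ : chunks d ≡ before ++ (g , just t) ∷ after
      is-segment : IsSegType t a c
      a≡i : val a ≡ val i
      i∈g : val i ∈ sources g
      rest : ListSeg (Removal.h′ (remove d before (g , just t) after chunks≡)) (val c) (val j)

  -- A nonempty list segment from val i to val j, cut at its first named location after val i.
  module FirstCut {h} (d : Decomposition h) (i j : Fin N) (c₀ : Loc) (cs : List Loc)
                  (U : Unique (sources (cells (val i) (c₀ ∷ cs)))) (last : lastL (val i) (c₀ ∷ cs) ≡ val j)
                  (h≡P : ∀ l → fn h l ≡ lookupL (cells (val i) (c₀ ∷ cs)) l) where

    a₀ : Loc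
    a₀ = val i
    cut : ∃ λ us → ∃ λ dd → ∃ λ rest → c₀ ∷ cs ≡ us ++ dd ∷ rest × All (λ u → ¬ Named u) us × Named dd
    cut = first-named a₀ (c₀ ∷ cs) (λ ()) (subst Named (sym last) (j , refl))
    us : List Loc
    us = proj₁ cut
    dd : Loc
    dd = proj₁ (proj₂ cut)
    rest : List Loc
    rest = proj₁ (proj₂ (proj₂ cut))
    unnamed-us : All (λ u → ¬ Named u) us
    unnamed-us = proj₁ (proj₂ (proj₂ (proj₂ (proj₂ cut))))
    named-dd : Named dd
    named-dd = proj₂ (proj₂ (proj₂ (proj₂ (proj₂ cut))))
    P G R : List Edge
    P = cells a₀ (c₀ ∷ cs)
    G = cells a₀ (us ++ dd ∷ [])
    R = cells dd rest

    P≡G++R : P ≡ G ++ R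
    P≡G++R = trans (cong (cells a₀) (proj₁ (proj₂ (proj₂ (proj₂ cut))))) (cells-++-split a₀ us dd rest)

    sources-G : sources G ≡ a₀ ∷ us
    sources-G = sources-cells a₀ us dd

    unique : Unique ((a₀ ∷ us) ++ sources R)
    unique = subst Unique (trans (cong sources P≡G++R) (trans (sources-++ G R) (cong (_++ sources R) sources-G))) U

    last-R : lastL dd rest ≡ val j
    last-R = trans (sym (trans (cong (lastL a₀) (proj₁ (proj₂ (proj₂ (proj₂ cut))))) (lastL-++ a₀ us (dd ∷ rest)))) last

    P⊆h : ∀ {e} → e ∈ P → e ∈H h
    P⊆h {x , y} m = inH (trans (h≡P x) (lookupL-complete P (Unique-sources⇒Functional P U) m))

    h⊆P : ∀ {e} → e ∈H h → e ∈ P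
    h⊆P {x , y} (inH q) = lookupL-sound P (trans (sym (h≡P x)) q)

    -- R shares no source with G, nor an unnamed location, since dd is the first named one.
    G-closed : ∀ {e e′} → e ∈ G → e′ ∈H h → Linked e e′ → e′ ∈ G
    G-closed {e} {e′} m q lk with ∈-++⁻ G (subst (e′ ∈_) P≡G++R (h⊆P q))
    ... | inj₁ m₁ = m₁
    ... | inj₂ m₂ = ⊥-elim (G-R-unlinked lk)
      where
      G-R-unlinked : Linked e e′ → ⊥
      G-R-unlinked (inj₂ same-source) =
        Unique-++-disjoint (a₀ ∷ us) unique (subst (_ ∈_) sources-G (∈-sources⁺ G m))
            (subst (_∈ sources R) (sym same-source) (∈-sources⁺ R m₂))
      G-R-unlinked (inj₁ (l , lm , lm′ , unnamed)) with ∈-cells-endpoint a₀ (us ++ dd ∷ []) m lm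
      ... | inj₁ refl = unnamed (i , refl)
      ... | inj₂ l∈us++dd with ∈-++⁻ us l∈us++dd
      ... | inj₂ (here refl) = unnamed named-dd
      ... | inj₁ l∈us with ∈-cells-endpoint dd rest m₂ lm′
      ... | inj₁ refl = unnamed named-dd
      ... | inj₂ l∈rest with ∈-cells-rest dd rest l∈rest
      ... | inj₁ l∈sources-R = Unique-++-disjoint (a₀ ∷ us) unique (there l∈us) l∈sources-R
      ... | inj₂ l≡last = unnamed (subst Named (sym (trans l≡last last-R)) (j , refl))

    component : ∃ λ C → C ∈ chunks d × proj₁ C ≅ G
    component = chunk-of-component d G (proj₂ (cells-last a₀ us dd)) (cells-connected a₀ us dd unnamed-us)
                                   (λ m → P⊆h (subst (_ ∈_) (sym P≡G++R) (∈-++⁺ˡ m))) G-closed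
    C : Chunk N
    C = proj₁ component
    C∈d : C ∈ chunks d
    C∈d = proj₁ (proj₂ component)
    g : List Edge
    g = proj₁ C
    g≅G : g ≅ G
    g≅G = proj₂ (proj₂ component)
    before after : List (Chunk N)
    before = proj₁ (∈-∃++ C∈d)
    after = proj₁ (proj₂ (∈-∃++ C∈d))

    a₀∈g : a₀ ∈ sources g
    a₀∈g = sources-mono (proj₂ g≅G) (subst (a₀ ∈_) (sym sources-G) (here refl))

    g-segment : IsSegment g a₀ dd us
    g-segment = g≅G , unnamed-us , Unique-++ˡ (a₀ ∷ us) unique , (i , refl) , named-dd

    rest-ListSeg : ∀ {t} (eq : chunks d ≡ before ++ (g , just t) ∷ after) →
                   ListSeg (Removal.h′ (remove d before (g , just t) after eq)) dd (val j)
    rest-ListSeg {t} eq = mkListSeg {h′} rest (Unique-++ʳ (a₀ ∷ us) unique) last-R h′≡R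
      where
      open Removal (remove d before (g , just t) after eq)
      h′≡R : ∀ l → fn h′ l ≡ lookupL R l
      h′≡R l with l ∈? sources g
      ... | yes l∈g = trans (removed l∈g) (sym (lookupL-∉ R (Unique-++-disjoint (a₀ ∷ us) unique
                                                               (subst (l ∈_) sources-G (sources-mono (proj₁ g≅G) l∈g)))))
      ... | no l∉g = trans (kept l∉g) (trans (h≡P l) (trans (cong (λ z → lookupL z l) P≡G++R) (trans (lookupL-++ G R l)
                       (cong (λ z → merge z (lookupL R l)) (lookupL-∉ G (λ m → l∉g (sources-mono (proj₂ g≅G) m)))))))

    first-segment : FirstSegment d i j
    first-segment = typed (proj₂ C) (classified d C∈d) (proj₂ (proj₂ (∈-∃++ C∈d)))
      where
      typed : ∀ mt → Classified g mt → chunks d ≡ before ++ (g , mt) ∷ after → FirstSegment d i j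
      typed nothing unnamed _ = ⊥-elim (unnamed a₀ a₀∈g (i , refl))
      typed (just (garbage S)) (_ , _ , _ , not-segment) _ = ⊥-elim (not-segment (a₀ , dd , us , g-segment))
      typed (just (ptr a c)) w eq with IsSegment-named-target w named-dd
          (proj₂ g≅G (proj₂ (cells-last a₀ us dd))) | IsSegment-named-source w (i , refl) a₀∈g
      ... | dd≡c | a≡i = record { before = before ; after = after ; g = g ; t = ptr a c ; a = a ; c = c ; chunks≡ = eq
                                ; is-segment = inj₁ refl ; a≡i = sym a≡i ; i∈g = a₀∈g
                                ; rest = subst (λ z → ListSeg (Removal.h′ (remove d before (g , just _) after eq)) z
                                    (val j)) dd≡c (rest-ListSeg eq) }
      typed (just (seg a c)) (_ , _ , w) eq with IsSegment-named-target w named-dd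
          (proj₂ g≅G (proj₂ (cells-last a₀ us dd))) | IsSegment-named-source w (i , refl) a₀∈g
      ... | dd≡c | a≡i = record { before = before ; after = after ; g = g ; t = seg a c ; a = a ; c = c ; chunks≡ = eq
                                ; is-segment = inj₂ refl ; a≡i = sym a≡i ; i∈g = a₀∈g
                                ; rest = subst (λ z → ListSeg (Removal.h′ (remove d before (g , just _) after eq)) z
                                    (val j)) dd≡c (rest-ListSeg eq) }

  ListSeg⇒chain : ∀ f {h} (d : Decomposition h) i j → length (types (chunks d)) ≡ f → ListSeg h (val i) (val j) →
                  chain f (types (chunks d)) i j ≡ true × anonymous (chunks d) ≡ 0
  ListSeg⇒chain f d i j _ (inj₁ (eh , e)) =
    subst (λ Cs → chain f (types Cs) i j ≡ true) (sym no-chunks-d) (≡⇒≈ᵇ e) , subst (λ Cs → anonymous Cs ≡ 0)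
        (sym no-chunks-d) refl
    where no-chunks-d = empty⇒no-chunks d eh
  ListSeg⇒chain f {h} d i j len (inj₂ (c₀ , cs , U , last , h≡P)) = with-fuel f len
    where
    open FirstSegment (FirstCut.first-segment d i j c₀ cs U last h≡P)
    open Removal (remove d before (g , just t) after chunks≡) using (h′ ; d′ ; chunks-d′ ; removed)
    types-d′ : types (chunks d′) ≡ types before ++ types after
    types-d′ = trans (cong types chunks-d′) (types-++ before after)
    length-d : length (types (chunks d)) ≡ suc (length (types (chunks d′)))
    length-d = trans (cong (λ z → length (types z)) chunks≡) (trans (cong length (types-middle before g t after))
                 (trans (length-++-sucʳ (types before) t (types after)) (cong suc (cong length (sym types-d′)))))
    with-fuel : ∀ f → length (types (chunks d)) ≡ f → chain f (types (chunks d)) i j ≡ true × anonymous (chunks d) ≡ 0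
    with-fuel zero len′ = ⊥-elim (1+n≢0 (trans (sym length-d) len′))
    with-fuel (suc f′) len′ = chain-intro f′ (types (chunks d)) picked step , no-anonymous
      where
      ih = ListSeg⇒chain f′ d′ c j (suc-injective (trans (sym length-d) len′)) rest
      picked : (t , types (chunks d′)) ∈ picks (types (chunks d))
      picked = subst₂ (λ A B → (t , A) ∈ picks B) (sym types-d′)
          (sym (trans (cong types chunks≡) (types-middle before g t after)))
                 (∈-picks⁺ (types before) t (types after))
      i-free : not (allocated (types (chunks d′)) i) ≡ true
      i-free = not-intro _ (λ q → let (_ , qv) = proj₁ (allocated-correct d′ i) q in just≢nothing (trans (sym qv) (removed i∈g)))
      step : chainStep f′ t (types (chunks d′)) i j ≡ true
      step = trans (chainStep-seg is-segment) (∧-intro (≡⇒≈ᵇ a≡i) (∧-intro i-free (proj₁ ih)))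
      no-anonymous : anonymous (chunks d) ≡ 0
      no-anonymous = trans (cong anonymous chunks≡)
          (trans (anonymous-middle before g t after) (trans (cong anonymous (sym chunks-d′)) (proj₂ ih)))

  -- Correctness of the abstract semantics

  module Correctness (nilIx-nil : L.lookup xs nilIx ≡ nil) where

    open Indexing xs
    open Equivalence using (to; from)

    s-index : ∀ {x} (m : x ∈ xs) → s x ≡ just (val (index m))
    s-index m = trans (cong s (lookup-index m)) (s-val (index m))

    Sat : ∀ {h} → Decomposition h → IForm N → Bool
    Sat d a = sat (types (chunks d)) (anonymous (chunks d)) a

    record Correct (a : IForm N) (φ : Form) : Set₁ where
      field at : ∀ {h} (d : Decomposition h) → (s , h ⊨ φ) ⇔ (Sat d a ≡ true)
    open Correct public

    pure-correct : ∀ {h} (d : Decomposition h) (b : Bool) →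
      (EmptyHeap h × b ≡ true) ⇔ ((anonymous (chunks d) ≡ᵇ 0) ∧ (null (types (chunks d)) ∧ b) ≡ true)
    pure-correct d b = mk⇔
      (λ (eh , q) → subst (λ Cs → (anonymous Cs ≡ᵇ 0) ∧ (null (types Cs) ∧ b) ≡ true) (sym (empty⇒no-chunks d eh)) q)
      (λ q → let n≡0 = ≡ᵇ0⇒≡0 _ (∧-elimˡ (anonymous (chunks d) ≡ᵇ 0) q)
                 q′ = ∧-elimʳ (anonymous (chunks d) ≡ᵇ 0) q
             in no-chunks⇒empty d (no-chunks (chunks d) (null⇒≡[] _ (∧-elimˡ (null (types (chunks d))) q′)) n≡0) ,
                ∧-elimʳ (null (types (chunks d))) q′)

    emp-correct : Correct empᴵ emp
    at emp-correct d = mk⇔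
      (λ eh → subst (λ Cs → (anonymous Cs ≡ᵇ 0) ∧ null (types Cs) ≡ true) (sym (empty⇒no-chunks d eh)) refl)
      (λ q → no-chunks⇒empty d (no-chunks (chunks d) (null⇒≡[] _ (∧-elimʳ (anonymous (chunks d) ≡ᵇ 0) q))
                                                      (≡ᵇ0⇒≡0 _ (∧-elimˡ (anonymous (chunks d) ≡ᵇ 0) q))))

    eq-correct : ∀ {x y} (mx : x ∈ xs) (my : y ∈ xs) → Correct (eqᴵ (index mx) (index my)) (x ≐ y)
    at (eq-correct mx my) d = mk⇔
      (λ (eh , a , qx , qy) → to (pure-correct d _)
         (eh , ≡⇒≈ᵇ (just-injective (trans (sym (s-index mx)) (trans qx (trans (sym qy) (s-index my)))))))
      (λ q → let (eh , aliased) = from (pure-correct d _) q in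
             eh , val (index mx) , s-index mx , trans (s-index my) (cong just (sym (≈ᵇ⇒≡ aliased))))

    neq-correct : ∀ {x y} (mx : x ∈ xs) (my : y ∈ xs) → Correct (neqᴵ (index mx) (index my)) (x ≠ y)
    at (neq-correct mx my) d = mk⇔
      (λ (eh , a , b , qx , qy , a≢b) → to (pure-correct d _)
         (eh , not-intro _ (λ aliased → a≢b (trans (just-injective (trans (sym qx) (s-index mx)))
                                             (trans (≈ᵇ⇒≡ aliased) (just-injective (trans (sym (s-index my)) qy)))))))
      (λ q → let (eh , unaliased) = from (pure-correct d _) q in
             eh , val (index mx) , val (index my) , s-index mx , s-index my , λ e → not-elim _ unaliased (≡⇒≈ᵇ e))

    single-cell-chunk : ∀ {h a b} (d : Decomposition h) → (∀ l → fn h l ≡ lookupL ((a , b) ∷ []) l) →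
                        ∃ λ C → chunks d ≡ C ∷ [] × proj₁ C ≅ (a , b) ∷ []
    single-cell-chunk {h} {a} {b} d h≡ab = C , only-C , C≅G
      where
      G = (a , b) ∷ []
      in-h : ∀ {e} → e ∈ G → e ∈H h
      in-h (here refl) = inH (trans (h≡ab a) (lookupL-complete G (λ { (here refl) (here refl) → refl }) (here refl)))
      in-G : ∀ {e} → e ∈H h → e ∈ G
      in-G {x , y} (inH q) = lookupL-sound G (trans (sym (h≡ab x)) q)
      component = chunk-of-component d G (here refl) (Connected-singleton _) in-h (λ _ q _ → in-G q)
      C = proj₁ component
      mC = proj₁ (proj₂ component)
      C≅G = proj₂ (proj₂ component)
      all-C : ∀ {C′} → C′ ∈ chunks d → C′ ≡ C
      all-C m′ with inhabited d m′
      ... | e , me with ∈-AllPairs₂ (apart d) mC m′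
      ... | inj₁ e₁ = sym e₁
      ... | inj₂ (inj₁ sp) = ⊥-elim (sp (proj₂ C≅G (in-G (sound d m′ me))) me (inj₂ refl))
      ... | inj₂ (inj₂ sp) = ⊥-elim (sp me (proj₂ C≅G (in-G (sound d m′ me))) (inj₂ refl))
      only-C : chunks d ≡ C ∷ []
      only-C with chunks d in eq
      ... | [] = ⊥-elim (¬∈[] (subst (C ∈_) eq mC))
        where
        ¬∈[] : C ∉ []
        ¬∈[] ()
      ... | x ∷ [] = cong (_∷ []) (all-C (subst (x ∈_) (sym eq) (here refl)))
      ... | x ∷ y ∷ _ with subst (AllPairs ChunksApart) eq (apart d)
      ... | (x-apart-y ∷ _) ∷ _ with all-C (subst (x ∈_) (sym eq) (here refl)) | all-C (subst (y ∈_) (sym eq) (there (here refl)))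
      ... | refl | refl = ⊥-elim (x-apart-y (proj₂ C≅G (here refl)) (proj₂ C≅G (here refl)) (inj₂ refl))

    pts-sound : ∀ {h} (d : Decomposition h) i j → (∀ l → fn h l ≡ lookupL ((val i , val j) ∷ []) l) →
                (anonymous (chunks d) ≡ᵇ 0) ∧ isPtr (types (chunks d)) i j ≡ true
    pts-sound d i j h≡ij with single-cell-chunk d h≡ij
    ... | (g , mt) , only-C , g≅ij =
      subst (λ Cs → (anonymous Cs ≡ᵇ 0) ∧ isPtr (types Cs) i j ≡ true) (sym only-C)
            (typed-ptr mt (classified d (subst ((g , mt) ∈_) (sym only-C) (here refl))))
      where
      typed-ptr : ∀ mt → Classified g mt → (anonymous ((g , mt) ∷ []) ≡ᵇ 0) ∧ isPtr (types ((g , mt) ∷ [])) i j ≡ true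
      typed-ptr nothing unnamed = ⊥-elim (unnamed (val i) (∈-sources⁺ _ (proj₂ g≅ij (here refl))) (i , refl))
      typed-ptr (just (garbage S)) (_ , _ , _ , not-segment) =
        ⊥-elim (not-segment (val i , val j , [] , g≅ij , [] , ([] ∷ []) , (i , refl) , (j , refl)))
      typed-ptr (just (seg _ _)) (_ , _ , (g≅path , (unnamed ∷ _) , _)) with proj₁ g≅ij (proj₂ g≅path (here refl))
      ... | here e = ⊥-elim (unnamed (j , sym (cong proj₂ e)))
      typed-ptr (just (ptr _ _)) (g≅path , _) with proj₁ g≅ij (proj₂ g≅path (here refl))
      ... | here e = ∧-intro (≡⇒≈ᵇ (cong proj₁ e)) (≡⇒≈ᵇ (cong proj₂ e))

    isPtr-elim : ∀ T {x y} → isPtr T x y ≡ true → ∃₂ λ a c → T ≡ ptr a c ∷ [] × a ≈ᵇ x ≡ true × c ≈ᵇ y ≡ true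
    isPtr-elim (ptr a c ∷ []) q = a , c , refl , ∧-elimˡ (a ≈ᵇ _) q , ∧-elimʳ (a ≈ᵇ _) q

    single-chunk : ∀ (Cs : List (Chunk N)) {t} → types Cs ≡ t ∷ [] → anonymous Cs ≡ 0 → ∃ λ g → Cs ≡ (g , just t) ∷ []
    single-chunk ((g , just t) ∷ Cs) e c with no-chunks Cs (∷-injectiveʳ e) c
    ... | refl = g , cong (λ z → (g , just z) ∷ []) (∷-injectiveˡ e)

    pts-complete : ∀ {h} (d : Decomposition h) i j → (anonymous (chunks d) ≡ᵇ 0) ∧ isPtr (types (chunks d)) i j ≡ true →
                   ∀ l → fn h l ≡ lookupL ((val i , val j) ∷ []) l
    pts-complete {h} d i j q with isPtr-elim (types (chunks d)) (∧-elimʳ (anonymous (chunks d) ≡ᵇ 0) q)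
    ... | a , c , eqT , a≈i , c≈j with single-chunk (chunks d) eqT (≡ᵇ0⇒≡0 _ (∧-elimˡ (anonymous (chunks d) ≡ᵇ 0) q))
    ... | g , only-g = λ l → Maybe-ext (fn⇒ l) (⇒fn l)
      where
      mg : (g , just (ptr a c)) ∈ chunks d
      mg = subst (_ ∈_) (sym only-g) (here refl)
      g≅ac : g ≅ (val a , val c) ∷ []
      g≅ac = proj₁ (classified d mg)
      ac≡ij : (val a , val c) ≡ (val i , val j)
      ac≡ij = cong₂ _,_ (≈ᵇ⇒≡ a≈i) (≈ᵇ⇒≡ c≈j)
      fn⇒ : ∀ l v → fn h l ≡ just v → lookupL ((val i , val j) ∷ []) l ≡ just v
      fn⇒ l v q₁ with complete d (inH {l , v} {h} q₁)
      ... | C , m , me with subst (C ∈_) only-g m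
      ... | here refl with proj₁ g≅ac me
      ... | here e = lookupL-complete ((val i , val j) ∷ []) (λ { (here refl) (here refl) → refl }) (here (trans e ac≡ij))
      ⇒fn : ∀ l v → lookupL ((val i , val j) ∷ []) l ≡ just v → fn h l ≡ just v
      ⇒fn l v q₁ with lookupL-sound _ q₁
      ... | here e = unH (sound d mg (proj₂ g≅ac (here (trans e (sym ac≡ij)))))

    pts-correct : ∀ {x y} (mx : x ∈ xs) (my : y ∈ xs) → Correct (ptsᴵ (index mx) (index my)) (x ↦ y)
    at (pts-correct mx my) d = mk⇔
      (λ (a , b , qx , qy , h≡ab) → pts-sound d (index mx) (index my)
         (subst₂ (λ a b → ∀ l → _ ≡ lookupL ((a , b) ∷ []) l)
                 (just-injective (trans (sym qx) (s-index mx))) (just-injective (trans (sym qy) (s-index my))) h≡ab))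
      (λ q → val (index mx) , val (index my) , s-index mx , s-index my , pts-complete d (index mx) (index my) q)

    ls-correct : ∀ {x y} (mx : x ∈ xs) (my : y ∈ xs) → Correct (lsᴵ (index mx) (index my)) (ls x y)
    at (ls-correct {x} {y} mx my) {h} d = mk⇔
      (λ sm → let (is-chain , no-anonymous) = ListSeg⇒chain (length (types (chunks d))) d i j refl (toListSeg sm)
              in ∧-intro (cong (_≡ᵇ 0) no-anonymous) is-chain)
      (λ q → fromListSeg (chain⇒ListSeg (length (types (chunks d))) d i j refl
                            (≡ᵇ0⇒≡0 _ (∧-elimˡ (anonymous (chunks d) ≡ᵇ 0) q)) (∧-elimʳ (anonymous (chunks d) ≡ᵇ 0) q)))
      where
      i = index mx
      j = index my
      toListSeg : s , h ⊨ ls x y → ListSeg h (val i) (val j)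
      toListSeg (inj₁ (eh , a , qx , qy)) = inj₁
          (eh , just-injective (trans (sym (s-index mx)) (trans qx (trans (sym qy) (s-index my)))))
      toListSeg (inj₂ (a , c , cs , qx , qy , u , h≡cells)) with just-injective (trans (sym (s-index mx)) qx)
      ... | refl = inj₂ (c , cs , u , just-injective (trans (sym qy) (s-index my)) , h≡cells)
      fromListSeg : ListSeg h (val i) (val j) → s , h ⊨ ls x y
      fromListSeg (inj₁ (eh , e)) = inj₁ (eh , val i , s-index mx , trans (s-index my) (cong just (sym e)))
      fromListSeg (inj₂ (c , cs , u , last , h≡cells)) =
        inj₂ (val i , c , cs , s-index mx , trans (s-index my) (cong just (sym last)) , u , h≡cells)

    ⋆-correct : ∀ {a b φ ψ} → Correct a φ → Correct b ψ → Correct (a ⋆ᴵ b) (φ ⋆ ψ)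
    at (⋆-correct {a} {b} {φ} {ψ} cφ cψ) {h} d = mk⇔ sound′ complete′
      where
      sound′ : s , h ⊨ (φ ⋆ ψ) → Sat d (a ⋆ᴵ b) ≡ true
      sound′ (h₁ , h₂ , U , s₁ , s₂) with splitDecomposition {h} {h₁} {h₂} U d
      ... | d₁ , d₂ , i = any-intro _ (∈-splits⁺ (types-interleaving i)) (any-intro _ (∈-range⁺ k≤n)
            (∧-intro (to (at cφ d₁) s₁) (subst (λ z → sat (types (chunks d₂)) z b ≡ true) (sym n∸k) (to (at cψ d₂) s₂))))
        where
        n∸k : anonymous (chunks d) ∸ anonymous (chunks d₁) ≡ anonymous (chunks d₂)
        n∸k = trans (cong (_∸ anonymous (chunks d₁)) (anonymous-interleaving i))
            (m+n∸m≡n (anonymous (chunks d₁)) (anonymous (chunks d₂)))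
        k≤n : anonymous (chunks d₁) ≤ anonymous (chunks d)
        k≤n = subst (anonymous (chunks d₁) ≤_) (sym (anonymous-interleaving i)) (m≤m+n _ _)
      complete′ : Sat d (a ⋆ᴵ b) ≡ true → s , h ⊨ (φ ⋆ ψ)
      complete′ q with any-elim _ (splits (types (chunks d))) q
      ... | (T₁ , T₂) , mT , q₂ with any-elim _ (range (anonymous (chunks d))) q₂
      ... | k , mk , q₃ with interleaving-from-types (chunks d) k (∈-splits⁻ (types (chunks d)) mT) (∈-range⁻ mk)
      ... | Cs₁ , Cs₂ , i , refl , refl , refl , n∸k =
        restrict h (chunkSources Cs₁) , restrict h (chunkSources Cs₂) , restrict-union d i ,
        from (at cφ (restrictDecomposition d Cs₁ Cs₂ i)) (∧-elimˡ _ q₃) ,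
        from (at cψ (restrictDecomposition d Cs₂ Cs₁ (swap i)))
             (subst (λ z → sat (types Cs₂) z b ≡ true) (sym n∸k) (∧-elimʳ (sat (types Cs₁) (anonymous Cs₁) a) q₃))

    -- The anonymous chunks of the added heap are counted only up to the bounds of the two formulas.
    -⊛-sound : ∀ {a b φ ψ} → Correct a φ → Correct b ψ → ∀ {h} (d : Decomposition h) → s , h ⊨ (φ -⊛ ψ) → Sat d (a -⊛ᴵ b) ≡ true
    -⊛-sound {a} {b} cφ cψ {h} d (h₁ , h′ , model₁ , s₁ , U , s′) =
      let (m , m≤B , satₘ , satₘ′) = clamped in
      any-intro _ (types∈candidates d₁) (any-intro _ (∈-range⁺ m≤B)
        (∧-intro (consistent-correct d₁) (∧-intro (nilFree-correct d₁ nilIx-nil model₁)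
          (∧-intro (disjoint-correct d d₁ (proj₁ U)) (∧-intro satₘ satₘ′)))))
      where
      d₁ = decompose h₁
      T = types (chunks d)
      n = anonymous (chunks d)
      T₁ = types (chunks d₁)
      n₁ = anonymous (chunks d₁)
      B = bound a + bound b
      sat₁ : sat T₁ n₁ a ≡ true
      sat₁ = to (at cφ d₁) s₁
      sat′ : sat (T ++ T₁) (n + n₁) b ≡ true
      sat′ = subst₂ (λ T′ n′ → sat T′ n′ b ≡ true) (types-++ (chunks d) (chunks d₁)) (anonymous-++ (chunks d) (chunks d₁))
                    (to (at cψ (unionDecomposition {h} {h₁} {h′} d d₁ U)) s′)
      clamped : Σ ℕ λ m → m ≤ B × sat T₁ m a ≡ true × sat (T ++ T₁) (n + m) b ≡ true
      clamped with n₁ ≤? B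
      ... | yes n₁≤B = n₁ , n₁≤B , sat₁ , sat′
      ... | no n₁≰B =
        B , ≤-refl ,
        trans (sym (sat-stable a T₁ (≤-trans (m≤m+n (bound a) (bound b)) (<⇒≤ (≰⇒> n₁≰B))) (m≤m+n (bound a) (bound b)))) sat₁ ,
        trans (sym (sat-stable b (T ++ T₁) (≤-trans (≤-trans (m≤n+m (bound b) (bound a)) (<⇒≤ (≰⇒> n₁≰B))) (m≤n+m n₁ n))
                                           (≤-trans (m≤n+m (bound b) (bound a)) (m≤n+m B n)))) sat′

    location-bound : ∀ h → ∃ λ F → (∀ i → val i < F) × (∀ {l} → inLocs h l → l < F)
    location-bound h = suc (maximum candidates′) , val<F , locs<F
      where
      Lh = proj₁ (fin h)
      candidates′ = Lh ++ (images h Lh ++ map val (allFin N))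
      val<F : ∀ i → val i < suc (maximum candidates′)
      val<F i = s≤s (≤-maximum candidates′ (∈-++⁺ʳ Lh (∈-++⁺ʳ (images h Lh) (∈-map⁺ val (∈-allFin i)))))
      locs<F : ∀ {l} → inLocs h l → l < suc (maximum candidates′)
      locs<F {l} (inj₁ (v , q)) = s≤s (≤-maximum candidates′ (∈-++⁺ˡ (proj₂ (fin h) l v q)))
      locs<F {l} (inj₂ (k , q)) = s≤s (≤-maximum candidates′ (∈-++⁺ʳ Lh (∈-++⁺ˡ (∈-images h Lh (proj₂ (fin h) k l q) q))))

    -- The added heap is the realisation of the abstract witness, placed above all locations of h.
    -⊛-complete : ∀ {a b φ ψ} → Correct a φ → Correct b ψ → ∀ {h} (d : Decomposition h) → Sat d (a -⊛ᴵ b) ≡ true → s , h ⊨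
        (φ -⊛ ψ)
    -⊛-complete {a} {b} cφ cψ {h} d q with any-elim _ candidates q
    ... | T₁ , _ , q₂ with any-elim _ (range (bound a + bound b)) q₂
    ... | m , _ , q₃ with location-bound h
    ... | F , val<F , locs<F = h₁ , unionH h h₁ , realised-model T₁ m cons₁ nilIx-nil nil-free₁ , from (at cφ d₁) sat₁ , U
        , from (at cψ (unionDecomposition {h} {h₁} d d₁ U)) sat′
      where
      T = types (chunks d)
      n = anonymous (chunks d)
      cons₁ = ∧-elimˡ (consistent T₁) q₃
      q₄ = ∧-elimʳ (consistent T₁) q₃
      nil-free₁ = ∧-elimˡ (nilFree T₁) q₄
      q₅ = ∧-elimʳ (nilFree T₁) q₄
      disjoint₁ = ∧-elimˡ (disjoint T T₁) q₅
      q₆ = ∧-elimʳ (disjoint T T₁) q₅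
      open Realisation F val<F
      h₁ = realisedHeap T₁ m cons₁
      d₁ = realisedDecomposition T₁ m cons₁
      sat₁ : Sat d₁ a ≡ true
      sat₁ = subst₂ (λ T′ n′ → sat T′ n′ a ≡ true) (sym (realised-types T₁ m cons₁)) (sym (realised-anonymous T₁ m cons₁))
                    (∧-elimˡ (sat T₁ m a) q₆)
      sat′ : sat (types (chunks d ++ chunks d₁)) (anonymous (chunks d ++ chunks d₁)) b ≡ true
      sat′ = subst₂ (λ T′ n′ → sat T′ n′ b ≡ true)
               (sym (trans (types-++ (chunks d) (chunks d₁)) (cong (T ++_) (realised-types T₁ m cons₁))))
               (sym (trans (anonymous-++ (chunks d) (chunks d₁)) (cong (n +_) (realised-anonymous T₁ m cons₁))))
               (∧-elimʳ (sat T₁ m a) q₆)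
      dom-disjoint : ∀ l → ¬ (inDom h l × inDom h₁ l)
      dom-disjoint l (dh , dh₁) with Named? l
      ... | yes (k , refl) = not-elim _ (all-elim _ (allFin N) disjoint₁ (∈-allFin k))
                                        (∧-intro (proj₂ (allocated-correct d k) dh) (realised-allocated T₁ m cons₁ k dh₁))
      ... | no unnamed with realisedHeap-locs T₁ m cons₁ (inj₁ dh₁)
      ... | inj₁ named = unnamed named
      ... | inj₂ F≤l = <⇒≱ (locs<F (inj₁ dh)) F≤l
      shared⇒img : ∀ l → inLocs h l → inLocs h₁ l → imgS s l
      shared⇒img l in-h in-h₁ with realisedHeap-locs T₁ m cons₁ in-h₁
      ... | inj₁ named = Named⇒imgS named
      ... | inj₂ F≤l = ⊥-elim (<⇒≱ (locs<F in-h) F≤l)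
      U : IsUnionS s (unionH h h₁) h h₁
      U = (dom-disjoint , shared⇒img) , λ l → refl

    -⊛-correct : ∀ {a b φ ψ} → Correct a φ → Correct b ψ → Correct (a -⊛ᴵ b) (φ -⊛ ψ)
    at (-⊛-correct cφ cψ) d = mk⇔ (-⊛-sound cφ cψ d) (-⊛-complete cφ cψ d)

    ∧-correct : ∀ {a b φ ψ} → Correct a φ → Correct b ψ → Correct (a ∧ᴵ b) (φ ∧f ψ)
    at (∧-correct {a} cφ cψ) d = mk⇔
      (λ (sφ , sψ) → ∧-intro (to (at cφ d) sφ) (to (at cψ d) sψ))
      (λ q → from (at cφ d) (∧-elimˡ (Sat d a) q) , from (at cψ d) (∧-elimʳ (Sat d a) q))

    ∨-correct : ∀ {a b φ ψ} → Correct a φ → Correct b ψ → Correct (a ∨ᴵ b) (φ ∨f ψ)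
    at (∨-correct {a} cφ cψ) d = mk⇔
      (λ { (inj₁ sφ) → ∨-introˡ _ (to (at cφ d) sφ) ; (inj₂ sψ) → ∨-introʳ (Sat d a) (to (at cψ d) sψ) })
      (λ q → Sum.map (from (at cφ d)) (from (at cψ d)) (∨-elim (Sat d a) q))

    ¬-correct : ∀ {a φ} → Correct a φ → Correct (¬ᴵ a) (¬f φ)
    at (¬-correct cφ) d = mk⇔
      (λ ¬sφ → not-intro _ (λ q → ¬sφ (from (at cφ d) q)))
      (λ q sφ → not-elim _ q (to (at cφ d) sφ))

    correct : ∀ φ (p : fv φ ⊆ xs) → Correct (indexForm φ p) φ
    correct emp p = emp-correct
    correct (x ↦ y) p = pts-correct (p (here refl)) (p (there (here refl)))
    correct (ls x y) p = ls-correct (p (here refl)) (p (there (here refl)))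
    correct (x ≐ y) p = eq-correct (p (here refl)) (p (there (here refl)))
    correct (x ≠ y) p = neq-correct (p (here refl)) (p (there (here refl)))
    correct (φ ⋆ ψ) p = ⋆-correct (correct φ (++-⊆ˡ (fv φ) p)) (correct ψ (++-⊆ʳ (fv φ) p))
    correct (φ -⊛ ψ) p = -⊛-correct (correct φ (++-⊆ˡ (fv φ) p)) (correct ψ (++-⊆ʳ (fv φ) p))
    correct (φ ∧f ψ) p = ∧-correct (correct φ (++-⊆ˡ (fv φ) p)) (correct ψ (++-⊆ʳ (fv φ) p))
    correct (φ ∨f ψ) p = ∨-correct (correct φ (++-⊆ˡ (fv φ) p)) (correct ψ (++-⊆ʳ (fv φ) p))
    correct (¬f φ) p = ¬-correct (correct φ p)

-- Deciding entailment

valOf : ∀ {N} → Vec (Fin N) N → Fin N → ℕ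
valOf v i = toℕ (lookup v i)

module _ {N} (val : Fin N → ℕ) where

  private
    representativeOf : ℕ → Fin N → Fin N
    representativeOf l i with any? (λ j → val j ≟ l)
    ... | yes (j , _) = j
    ... | no _ = i

    representativeOf-val : ∀ i → val (representativeOf (val i) i) ≡ val i
    representativeOf-val i with any? (λ j → val j ≟ val i)
    ... | yes (j , e) = e
    ... | no _ = refl

    representativeOf-irrelevant : ∀ l i j → (∃ λ k → val k ≡ l) → representativeOf l i ≡ representativeOf l j
    representativeOf-irrelevant l i j named with any? (λ k → val k ≟ l)
    ... | yes _ = refl
    ... | no unnamed = ⊥-elim (unnamed named)

  -- A labelling by indices that aliases exactly the same variables as val.
  representative : Fin N → Fin N
  representative i = representativeOf (val i) i

  representative-≡ : ∀ i j → val i ≡ val j → representative i ≡ representative j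
  representative-≡ i j e = trans (cong (λ l → representativeOf l i) e) (representativeOf-irrelevant (val j) i j (j , refl))

  representative-≡⁻ : ∀ i j → representative i ≡ representative j → val i ≡ val j
  representative-≡⁻ i j e = trans (sym (representativeOf-val i)) (trans (cong val e) (representativeOf-val j))

  representatives : Vec (Fin N) N
  representatives = tabulate representative

  aliasing-representatives : aliasingOf val ≡ aliasingOf (valOf representatives)
  aliasing-representatives = tabulate-cong (λ i → tabulate-cong (λ j →
    ⌊⌋-⇔ (λ e → cong toℕ (trans (lookup∘tabulate _ i) (trans (representative-≡ i j e) (sym (lookup∘tabulate _ j)))))
         (λ e → representative-≡⁻ i j (trans (sym (lookup∘tabulate _ i)) (trans (Fin.toℕ-injective e) (lookup∘tabulate _ j))))
         (val i ≟ val j) (valOf representatives i ≟ valOf representatives j)))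

module Decision (xs : List Var) (φ ψ : Form) (pφ : fv φ ⊆ xs) (pψ : fv ψ ⊆ xs)
                (nilIx : Fin (length xs)) (nilIx-nil : L.lookup xs nilIx ≡ nil) where

  N : ℕ
  N = length xs

  open Indexing xs

  φᴵ ψᴵ : IForm N
  φᴵ = indexForm φ pφ
  ψᴵ = indexForm ψ pψ

  B : ℕ
  B = bound φᴵ ⊔ bound ψᴵ

  -- Repeated entries of xs denote one variable and must get one value.
  respectsVars : Vec (Fin N) N → Bool
  respectsVars v = all (λ i → all (λ j → not ⌊ L.lookup xs i ≟ L.lookup xs j ⌋ ∨ ⌊ lookup v i Fin.≟ lookup v j ⌋) (allFin N))
      (allFin N)

  entailsAt : Vec (Fin N) N → List (ChunkType N) → ℕ → Bool
  entailsAt v T n = not (consistent T ∧ (nilFree T ∧ sat T n φᴵ)) ∨ sat T n ψᴵ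
    where open Abstract (aliasingOf (valOf v)) nilIx

  entailsFor : Vec (Fin N) N → Bool
  entailsFor v = not (respectsVars v) ∨ all (λ T → all (entailsAt v T) (range B))
      (Abstract.candidates (aliasingOf (valOf v)) nilIx)

  check : Bool
  check = all entailsFor (allVecs (allFin N) N)

  respectsVars⇒ : ∀ v → respectsVars v ≡ true → ∀ i j → L.lookup xs i ≡ L.lookup xs j → lookup v i ≡ lookup v j
  respectsVars⇒ v ok i j e with all-elim _ (allFin N) (all-elim _ (allFin N) ok (∈-allFin i)) (∈-allFin j)
  ... | q with L.lookup xs i ≟ L.lookup xs j
  ... | yes _ = dec-true⁻ (lookup v i Fin.≟ lookup v j) q
  ... | no ne = ⊥-elim (ne e)

  respectsVars-representatives : ∀ val → (∀ i j → L.lookup xs i ≡ L.lookup xs j → val i ≡ val j) →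
                                 respectsVars (representatives val) ≡ true
  respectsVars-representatives val val-respects =
    all-intro _ (allFin N) (λ i _ → all-intro _ (allFin N) (λ j _ → respects-at i j))
    where
    respects-at : ∀ i j → not ⌊ L.lookup xs i ≟ L.lookup xs j ⌋ ∨ ⌊ lookup (representatives val) i Fin.≟ lookup
        (representatives val) j ⌋ ≡ true
    respects-at i j with L.lookup xs i ≟ L.lookup xs j
    ... | no _ = refl
    ... | yes e = dec-true⁺ (lookup (representatives val) i Fin.≟ lookup (representatives val) j)
      (trans (lookup∘tabulate _ i) (trans (representative-≡ val i j (val-respects i j e)) (sym (lookup∘tabulate _ j))))

  check-sound : check ≡ true → Entails xs φ ψ
  check-sound ok s h dom model sφ = from (at (correct ψ pψ) d) satψ
    where
    val : Fin N → ℕ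
    val i = proj₁ (proj₁ (dom (L.lookup xs i)) (∈-lookup i))
    s-val : ∀ i → s (L.lookup xs i) ≡ just (val i)
    s-val i = proj₂ (proj₁ (dom (L.lookup xs i)) (∈-lookup i))
    s-dom : ∀ v l → s v ≡ just l → v ∈ xs
    s-dom v l q = proj₂ (dom v) l q
    open Concrete xs val s s-val s-dom nilIx using (chunks; decompose; consistent-correct; nilFree-correct; types∈candidates)
    open Concrete.Correctness xs val s s-val s-dom nilIx nilIx-nil using (correct; at)
    open Equivalence using (to; from)
    d = decompose h
    T = types (chunks d)
    n = anonymous (chunks d)
    v = representatives val
    same-aliasing = aliasing-representatives val
    respects : respectsVars v ≡ true
    respects = respectsVars-representatives val (λ i j e → just-injective (trans (sym (s-val i)) (trans (cong s e) (s-val j))))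
    premise : Abstract.consistent (aliasingOf (valOf v)) nilIx T ∧
              (Abstract.nilFree (aliasingOf (valOf v)) nilIx T ∧ Abstract.sat (aliasingOf (valOf v)) nilIx T (n ⊓ B) φᴵ) ≡ true
    premise = subst (λ A → Abstract.consistent A nilIx T ∧
        (Abstract.nilFree A nilIx T ∧ Abstract.sat A nilIx T (n ⊓ B) φᴵ) ≡ true)
                    same-aliasing
                    (∧-intro (consistent-correct d) (∧-intro (nilFree-correct d nilIx-nil model)
                       (trans (sym (Abstract.sat-clamp _ nilIx φᴵ T n (m≤m⊔n _ _))) (to (at (correct φ pφ) d) sφ))))
    satψ : Abstract.sat (aliasingOf val) nilIx T n ψᴵ ≡ true
    satψ = trans (Abstract.sat-clamp _ nilIx ψᴵ T n (m≤n⊔m _ _))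
             (subst (λ A → Abstract.sat A nilIx T (n ⊓ B) ψᴵ ≡ true) (sym same-aliasing)
               (not-∨-true premise
                 (all-elim _ (range B)
                   (all-elim _ (Abstract.candidates (aliasingOf (valOf v)) nilIx)
                     (not-∨-true respects (all-elim entailsFor (allVecs (allFin N) N) ok (∈-allVecs ∈-allFin v)))
                     (types∈candidates d))
                   (∈-range⁺ (m⊓n≤n n B)))))

  stackOf : (Fin N → ℕ) → Stack
  stackOf val x with x ∈? xs
  ... | yes m = just (val (index m))
  ... | no _ = nothing

  stackOf-dom : ∀ val → DomIs (stackOf val) xs
  stackOf-dom val x = defined , in-xs
    where
    defined : x ∈ xs → ∃ λ l → stackOf val x ≡ just l
    defined m with x ∈? xs
    ... | yes _ = _ , refl
    ... | no x∉xs = ⊥-elim (x∉xs m)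
    in-xs : ∀ l → stackOf val x ≡ just l → x ∈ xs
    in-xs l q with x ∈? xs
    ... | yes m = m

  check-complete : check ≡ false → ¬ Entails xs φ ψ
  check-complete fails entails with all-false entailsFor (allVecs (allFin N) N) fails
  ... | v , _ , q₁ with not-∨-false (respectsVars v) q₁
  ... | respects , q₂ with all-false _ (Abstract.candidates (aliasingOf (valOf v)) nilIx) q₂
  ... | T , _ , q₃ with all-false _ (range B) q₃
  ... | n , _ , q₄ with not-∨-false _ q₄
  ... | premise , ¬satψ = true≢false (trans (sym satψ) ¬satψ)
    where
    val = valOf v
    s = stackOf val
    s-val : ∀ i → s (L.lookup xs i) ≡ just (val i)
    s-val i with L.lookup xs i ∈? xs
    ... | yes m = cong (λ z → just (toℕ z)) (respectsVars⇒ v respects (index m) i (sym (lookup-index m)))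
    ... | no ∉xs = ⊥-elim (∉xs (∈-lookup i))
    s-dom : ∀ x l → s x ≡ just l → x ∈ xs
    s-dom x = proj₂ (stackOf-dom val x)
    open Concrete xs val s s-val s-dom nilIx using (chunks; consistent; nilFree; sat)
    open Concrete.Correctness xs val s s-val s-dom nilIx nilIx-nil using (correct; at)
    open Concrete.Realisation xs val s s-val s-dom nilIx N (λ i → Fin.toℕ<n (lookup v i))
      using (realisedHeap; realisedDecomposition; realised-types; realised-anonymous; realised-model)
    open Equivalence using (to; from)
    cons = ∧-elimˡ (consistent T) premise
    nil-free = ∧-elimˡ (nilFree T) (∧-elimʳ (consistent T) premise)
    satφ = ∧-elimʳ (nilFree T) (∧-elimʳ (consistent T) premise)
    h = realisedHeap T n cons
    d = realisedDecomposition T n cons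
    sφ : s , h ⊨ φ
    sφ = from (at (correct φ pφ) d)
        (subst₂ (λ T′ n′ → sat T′ n′ φᴵ ≡ true) (sym (realised-types T n cons)) (sym (realised-anonymous T n cons)) satφ)
    satψ : sat T n ψᴵ ≡ true
    satψ = subst₂ (λ T′ n′ → sat T′ n′ ψᴵ ≡ true) (realised-types T n cons) (realised-anonymous T n cons)
             (to (at (correct ψ pψ) d) (entails s h (stackOf-dom val) (realised-model T n cons nilIx-nil nil-free) sφ))

  decide : Dec (Entails xs φ ψ)
  decide with check in eq
  ... | true = yes (check-sound eq)
  ... | false = no (check-complete eq)

mainTheorem8 : (xs : List Var) (φ ψ : Form) → fv φ ⊆ xs → fv ψ ⊆ xs → Dec (Entails xs φ ψ)
mainTheorem8 xs φ ψ pφ pψ with nil ∈? xs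
-- Without nil in xs no stack with domain xs belongs to a model: the entailment holds vacuously.
... | no nil∉xs = yes (λ s h dom (n , s-nil , _) _ → ⊥-elim (nil∉xs (proj₂ (dom nil) n s-nil)))
... | yes m = Decision.decide xs φ ψ pφ pψ (index m) (sym (lookup-index m))
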